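{- The word $\mathsf{ABCC}$ (with $\mathsf A,\mathsf B,\mathsf C$ distinct letters) is $2$-stackable; that is, $C_2(\mathsf{ABCC})=3C_1(\mathsf{ABCC})=6/5$.
   Context: A $d$-dimensional grid of shape $G=\prod_{i=1}^d\mathbb Z/n_i\mathbb Z$ is a map $\Gamma\colon G\to\Sigma$ to an alphabet; its size is $|G|$. For a word $w=w_0\cdots w_{\ell-1}$, an appearance is a pair $(p,\mathbf v)\in G\times(\{ -1,0,1\}^d\setminus\{\mathbf 0\})$ with $\Gamma(p+i\mathbf v)=w_i$ for $0\le i<\ell$. The concentration $c_d(w,\Gamma)$ is the number of appearances divided by $|G|$, and $C_d(w)$ is its supremum over all $d$-dimensional grids. A word is $d$-stackable if $C_d(w)=3^{d-1}C_1(w)$; $C_1(\mathsf{ABCC})=2/5$. -}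

module Defs where

open import Data.Nat using (ℕ; zero; suc; _+_; _*_)
open import Data.Nat.DivMod using (_mod_)
open import Data.Fin using (Fin; zero; suc; toℕ)
open import Data.Bool using (Bool; true; false; _∧_; if_then_else_)
open import Data.List using (List; allFin; map)
open import Data.Nat.ListAction using (sum)
open import Relation.Binary.Definitions using (DecidableEquality)
open import Relation.Nullary.Decidable using (⌊_⌋)
open import Data.Integer using (+_)
open import Data.Rational using (ℚ; _/_)

-- A 2-dimensional grid of shape (ℤ/(suc a)ℤ) × (ℤ/(suc b)ℤ) over alphabet Σ.
-- (Both side lengths are ≥ 1, so the size |G| = (suc a) * (suc b) is positive.)
record Grid2 (Σ : Set) : Set where
  constructor grid
  field
    a b : ℕ
    Γ   : Fin (suc a) → Fin (suc b) → Σ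
open Grid2 public

size : ∀ {Σ} → Grid2 Σ → ℕ
size g = suc (a g) * suc (b g)

-- A coordinate of a direction vector, encoded by Fin 3:
--   zero ↦ 0,  suc zero ↦ 1,  suc (suc zero) ↦ -1  (represented mod m as m - 1)
-- The returned number is that residue for modulus (suc n), i.e. -1 ↦ n.
dir : ℕ → Fin 3 → ℕ
dir n zero = 0
dir n (suc zero) = 1
dir n (suc (suc zero)) = n

move : ∀ n → Fin (suc n) → Fin 3 → ℕ → Fin (suc n)
move n x v i = (toℕ x + i * dir n v) mod (suc n)

nonzero : Fin 3 → Fin 3 → Bool
nonzero zero zero = false
nonzero _ _ = true

allB : ∀ {ℓ} → (Fin ℓ → Bool) → Bool
allB {zero} f = true
allB {suc ℓ} f = f zero ∧ allB (λ i → f (suc i))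

isAppearance : ∀ {Σ} → DecidableEquality Σ → ∀ {ℓ} → (Fin ℓ → Σ) → (g : Grid2 Σ) →
               Fin (suc (a g)) → Fin (suc (b g)) → Fin 3 → Fin 3 → Bool
isAppearance _≟_ w g x y v₁ v₂ =
  allB (λ i → ⌊ Γ g (move (a g) x v₁ (toℕ i)) (move (b g) y v₂ (toℕ i)) ≟ w i ⌋)

sumFin : ∀ {n} → (Fin n → ℕ) → ℕ
sumFin f = sum (map f (allFin _))

appearances : ∀ {Σ} → DecidableEquality Σ → ∀ {ℓ} → (Fin ℓ → Σ) → Grid2 Σ → ℕ
appearances _≟_ w g =
  sumFin {suc (a g)} λ x → sumFin {suc (b g)} λ y → sumFin {3} λ v₁ → sumFin {3} λ v₂ →
    if nonzero v₁ v₂ ∧ isAppearance _≟_ w g x y v₁ v₂ then 1 else 0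

c₂ : ∀ {Σ} → DecidableEquality Σ → ∀ {ℓ} → (Fin ℓ → Σ) → Grid2 Σ → ℚ
c₂ _≟_ w g = (+ appearances _≟_ w g) / (suc (a g) * suc (b g))

ABCC : ∀ {Σ : Set} → Σ → Σ → Σ → Fin 4 → Σ
ABCC A B C zero = A
ABCC A B C (suc zero) = B
ABCC A B C (suc (suc zero)) = C
ABCC A B C (suc (suc (suc zero))) = C

-- s is the supremum of a family f : I → ℚ (supremum taken in ℝ; since all
-- values are rational and s is rational this is: s is an upper bound and
-- every s - ε with ε > 0 rational is exceeded by some value).
open import Data.Rational using (_≤_; _<_; _-_; 0ℚ)
open import Data.Product using (Σ-syntax; _×_)

IsSup : ∀ {I : Set} → (I → ℚ) → ℚ → Set
IsSup {I} f s = ((i : I) → f i ≤ s) × ((ε : ℚ) → 0ℚ < ε → Σ[ i ∈ I ] (s - ε < f i))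

C₂≡ : ∀ {Σ} → DecidableEquality Σ → ∀ {ℓ} → (Fin ℓ → Σ) → ℚ → Set
C₂≡ {Σ} _≟_ w s = IsSup {Grid2 Σ} (c₂ _≟_ w) s

-- Discharging. Every appearance of ABCC puts a load of 2 on its 𝐀, 4 on its 𝐁 and 4 on its
-- first 𝐂, so the total load is 10 times the number of appearances. Call a cell rich if it
-- is an 𝐀 starting at least 7 appearances, or the 𝐁 (the first 𝐂) of an appearance along
-- each of the four axes through it. A rich 𝐁 claims 2 from every orthogonally adjacent 𝐀, a
-- rich 𝐀 claims 1 and a rich 𝐂 claims 2 from every orthogonally adjacent 𝐁. Claims move load
-- without changing the total, and a case analysis on the letters around a cell shows that
-- its load plus what it pays is at most 12 plus what it receives. Hence
-- 10 · #appearances ≤ 12 · |G|, that is c₂ ≤ 6/5, with equality for the 1 × 5 torus ABCCB.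

module Submission where

open import Data.Bool using (Bool; true; false; _∧_; _∨_; not; T; if_then_else_)
open import Data.Empty using (⊥; ⊥-elim)
open import Data.Fin using (Fin; zero; suc; toℕ)
open import Data.Fin.Patterns using (0F; 1F; 2F; 3F; 4F)
open import Data.Fin.Permutation using (Permutation; permutation)
open import Data.Fin.Properties using (toℕ-injective; toℕ-fromℕ<; toℕ<n)
open import Data.Integer as ℤ using (ℤ; +_; -[1+_]; _⊖_)
import Data.Integer.Properties as ℤ
import Data.Integer.Solver as ℤ-Solver
open import Data.List as List using (tabulate)
open import Data.List.Properties using (map-tabulate)
open import Data.Nat using (ℕ; zero; suc; _+_; _*_; _∸_; _≤_; _≤ᵇ_; _≤?_; z≤n; s≤s; s≤s⁻¹; NonZero)
open import Data.Nat.DivMod using (_%_; _mod_; %-distribˡ-+; m%n%n≡m%n; [m+kn]%n≡m%n; m<n⇒m%n≡m)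
open import Data.Nat.ListAction using () renaming (sum to sumList)
open import Data.Nat.Properties
  using (≤-refl; ≤-reflexive; ≤-trans; ≤ᵇ⇒≤; ≤⇒≤ᵇ; ≰⇒>; m≤m+n; m≤n+m; m+n∸m≡n; +-assoc; +-identityʳ; *-identityʳ; *-zeroʳ; *-suc;
         *-assoc; *-comm; +-mono-≤; +-monoʳ-≤; *-monoʳ-≤; *-monoˡ-≤; +-cancelʳ-≤; *-cancelˡ-≤; +-*-semiring; module ≤-Reasoning)
open import Algebra.Properties.Semiring.Sum +-*-semiring using (sum; sum-cong-≗; ∑-distrib-+; ∑-comm; ∑-permute; *-distribˡ-sum)
import Data.Nat.Solver as ℕ-Solver
open import Data.Product using (_×_; _,_; proj₁; proj₂)
open import Data.Rational as ℚ using (_/_; 0ℚ; _-_)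
import Data.Rational.Properties as ℚ
open import Data.Rational.Unnormalised as ℚᵘ using (mkℚᵘ; *≤*)
import Data.Rational.Unnormalised.Properties as ℚᵘ
open import Data.Sum using (_⊎_; inj₁; inj₂)
open import Data.Unit using (tt)
open import Data.Vec using (Vec; []; _∷_)
open import Function using (_∘_; id)
open import Relation.Binary.Definitions using (DecidableEquality)
open import Relation.Binary.PropositionalEquality
open import Relation.Nullary using (Dec; yes; no)
open import Relation.Nullary.Decidable using (⌊_⌋; dec-true; isYes≗does)

open import Defs

-- Finite sums

𝟙 : Bool → ℕ
𝟙 b = if b then 1 else 0

sumFin≡sum : ∀ {n} (f : Fin n → ℕ) → sumFin f ≡ sum f
sumFin≡sum {zero} f = refl
sumFin≡sum {suc n} f = cong (_+_ (f zero)) (begin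
  sumList (List.map f (tabulate suc))          ≡⟨ cong sumList (map-tabulate suc f) ⟩
  sumList (tabulate (f ∘ suc))                 ≡⟨ cong sumList (map-tabulate id (f ∘ suc)) ⟨
  sumFin (f ∘ suc)                              ≡⟨ sumFin≡sum (f ∘ suc) ⟩
  sum (f ∘ suc)                                 ∎)
  where open ≡-Reasoning

sum-mono-≤ : ∀ {n} {f g : Fin n → ℕ} → (∀ i → f i ≤ g i) → sum f ≤ sum g
sum-mono-≤ {zero} f≤g = z≤n
sum-mono-≤ {suc n} f≤g = +-mono-≤ (f≤g zero) (sum-mono-≤ (f≤g ∘ suc))

sum-const : ∀ n c → sum {n} (λ _ → c) ≡ n * c
sum-const zero c = refl
sum-const (suc n) c = cong (_+_ c) (sum-const n c)

∑² : ∀ {m n} → (Fin m → Fin n → ℕ) → ℕ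
∑² F = sum λ i → sum λ j → F i j

∑²-cong : ∀ {m n} {F G : Fin m → Fin n → ℕ} → (∀ i j → F i j ≡ G i j) → ∑² F ≡ ∑² G
∑²-cong F≗G = sum-cong-≗ λ i → sum-cong-≗ (F≗G i)

∑²-mono-≤ : ∀ {m n} {F G : Fin m → Fin n → ℕ} → (∀ i j → F i j ≤ G i j) → ∑² F ≤ ∑² G
∑²-mono-≤ F≤G = sum-mono-≤ λ i → sum-mono-≤ (F≤G i)

∑²-distrib-+ : ∀ {m n} (F G : Fin m → Fin n → ℕ) → ∑² (λ i j → F i j + G i j) ≡ ∑² F + ∑² G
∑²-distrib-+ F G = trans (sum-cong-≗ λ i → ∑-distrib-+ (F i) (G i)) (∑-distrib-+ (λ i → sum (F i)) (λ i → sum (G i)))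

∑²-*ˡ : ∀ {m n} k (F : Fin m → Fin n → ℕ) → ∑² (λ i j → k * F i j) ≡ k * ∑² F
∑²-*ˡ k F = sym (trans (*-distribˡ-sum k (λ i → sum (F i))) (sum-cong-≗ λ i → *-distribˡ-sum k (F i)))

∑²-const : ∀ m n c → ∑² {m} {n} (λ _ _ → c) ≡ m * n * c
∑²-const m n c = begin
  sum {m} (λ _ → sum {n} (λ _ → c)) ≡⟨ sum-cong-≗ {m} (λ _ → sum-const n c) ⟩
  sum {m} (λ _ → n * c)          ≡⟨ sum-const m (n * c) ⟩
  m * (n * c)                    ≡⟨ *-assoc m n c ⟨
  m * n * c                      ∎
  where open ≡-Reasoning

∑²-comm : ∀ {m n k l} (F : Fin m → Fin n → Fin k → Fin l → ℕ) →
          ∑² (λ i j → ∑² (λ u v → F i j u v)) ≡ ∑² (λ u v → ∑² (λ i j → F i j u v))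
∑²-comm F = begin
  sum (λ i → sum λ j → sum λ u → sum λ v → F i j u v) ≡⟨ sum-cong-≗ (λ i → ∑-comm (λ j u → sum λ v → F i j u v)) ⟩
  sum (λ i → sum λ u → sum λ j → sum λ v → F i j u v) ≡⟨ ∑-comm (λ i u → sum λ j → sum λ v → F i j u v) ⟩
  sum (λ u → sum λ i → sum λ j → sum λ v → F i j u v) ≡⟨ sum-cong-≗ (λ u → sum-cong-≗ (λ i → ∑-comm (λ j v → F i j u v))) ⟩
  sum (λ u → sum λ i → sum λ v → sum λ j → F i j u v) ≡⟨ sum-cong-≗ (λ u → ∑-comm (λ i v → sum λ j → F i j u v)) ⟩
  sum (λ u → sum λ v → sum λ i → sum λ j → F i j u v) ∎
  where open ≡-Reasoning

appearances≡∑² : ∀ {Σ} (_≟_ : DecidableEquality Σ) {ℓ} (w : Fin ℓ → Σ) (g : Grid2 Σ) →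
                 appearances _≟_ w g ≡ ∑² λ x y → ∑² λ v₁ v₂ → 𝟙 (nonzero v₁ v₂ ∧ isAppearance _≟_ w g x y v₁ v₂)
appearances≡∑² _≟_ w g = trans (sumFin≡sum λ x → sumFin (cell x)) (sum-cong-≗ λ x → sumFin≡sum (cell x))
  where
  cell : Fin (suc (a g)) → Fin (suc (b g)) → ℕ
  cell x y = sumFin λ v₁ → sumFin λ v₂ → if nonzero v₁ v₂ ∧ isAppearance _≟_ w g x y v₁ v₂ then 1 else 0

-- Translations of ℤ/(1 + n)ℤ

-- -[1+ k ] is represented by (1 + k) · n, which is congruent to -(1 + k) modulo 1 + n.
residue : ℕ → ℤ → ℕ
residue n (+ k) = k
residue n -[1+ k ] = suc k * n

carry : ℤ → ℕ
carry (+ _) = 0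
carry -[1+ k ] = suc k

residue-correct : ∀ n i → + residue n i ≡ i ℤ.+ + carry i ℤ.* + suc n
residue-correct n (+ k) = sym (ℤ.+-identityʳ (+ k))
residue-correct n -[1+ k ] = sym (begin
  (suc k * suc n) ⊖ suc k          ≡⟨ cong (_⊖ suc k) (*-suc (suc k) n) ⟩
  (suc k + suc k * n) ⊖ suc k      ≡⟨ ℤ.⊖-≥ (m≤m+n (suc k) _) ⟩
  + (suc k + suc k * n ∸ suc k)    ≡⟨ cong +_ (m+n∸m≡n (suc k) _) ⟩
  + (suc k * n)                    ∎)
  where open ≡-Reasoning

+-+-* : ∀ r c N → + (r + c * N) ≡ + r ℤ.+ + c ℤ.* + N
+-+-* r c N = trans (ℤ.pos-+ r (c * N)) (cong (ℤ._+_ (+ r)) (ℤ.pos-* c N))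

residue-+ : ∀ n i j → (residue n i + residue n j) % suc n ≡ residue n (i ℤ.+ j) % suc n
residue-+ n i j = begin
  (rᵢ + rⱼ) % N                              ≡⟨ [m+kn]%n≡m%n (rᵢ + rⱼ) (carry (i ℤ.+ j)) N ⟨
  (rᵢ + rⱼ + carry (i ℤ.+ j) * N) % N        ≡⟨ cong (_% N) (ℤ.+-injective lifted) ⟩
  (rᵢ₊ⱼ + (carry i + carry j) * N) % N       ≡⟨ [m+kn]%n≡m%n rᵢ₊ⱼ (carry i + carry j) N ⟩
  rᵢ₊ⱼ % N                                   ∎
  where
  open ≡-Reasoning
  N rᵢ rⱼ rᵢ₊ⱼ : ℕ
  N = suc n
  rᵢ = residue n i
  rⱼ = residue n j
  rᵢ₊ⱼ = residue n (i ℤ.+ j)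
  lifted : + (rᵢ + rⱼ + carry (i ℤ.+ j) * N) ≡ + (rᵢ₊ⱼ + (carry i + carry j) * N)
  lifted = begin
    + (rᵢ + rⱼ + carry (i ℤ.+ j) * N)
      ≡⟨ +-+-* (rᵢ + rⱼ) (carry (i ℤ.+ j)) N ⟩
    + (rᵢ + rⱼ) ℤ.+ + carry (i ℤ.+ j) ℤ.* + N
      ≡⟨ cong (ℤ._+ + carry (i ℤ.+ j) ℤ.* + N) (trans (ℤ.pos-+ rᵢ rⱼ) (cong₂ ℤ._+_ (residue-correct n i) (residue-correct n j))) ⟩
    (i ℤ.+ + carry i ℤ.* + N) ℤ.+ (j ℤ.+ + carry j ℤ.* + N) ℤ.+ + carry (i ℤ.+ j) ℤ.* + N
      ≡⟨ solve 6 (λ i j cᵢ cⱼ c N → (i :+ cᵢ :* N) :+ (j :+ cⱼ :* N) :+ c :* N := (i :+ j :+ c :* N) :+ (cᵢ :+ cⱼ) :* N)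
               refl i j (+ carry i) (+ carry j) (+ carry (i ℤ.+ j)) (+ N) ⟩
    (i ℤ.+ j ℤ.+ + carry (i ℤ.+ j) ℤ.* + N) ℤ.+ (+ carry i ℤ.+ + carry j) ℤ.* + N
      ≡⟨ cong₂ (λ r c → r ℤ.+ c ℤ.* + N) (residue-correct n (i ℤ.+ j)) (ℤ.pos-+ (carry i) (carry j)) ⟨
    + rᵢ₊ⱼ ℤ.+ + (carry i + carry j) ℤ.* + N
      ≡⟨ +-+-* rᵢ₊ⱼ (carry i + carry j) N ⟨
    + (rᵢ₊ⱼ + (carry i + carry j) * N) ∎
    where open ℤ-Solver.+-*-Solver

shift : ∀ {n} → Fin (suc n) → ℤ → Fin (suc n)
shift {n} x i = (toℕ x + residue n i) mod suc n

toℕ-shift : ∀ {n} (x : Fin (suc n)) i → toℕ (shift x i) ≡ (toℕ x + residue n i) % suc n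
toℕ-shift x i = toℕ-fromℕ< _

%-+-congʳ : ∀ m {a b} N .{{_ : NonZero N}} → a % N ≡ b % N → (m + a) % N ≡ (m + b) % N
%-+-congʳ m {a} {b} N a≡b = begin
  (m + a) % N              ≡⟨ %-distribˡ-+ m a N ⟩
  (m % N + a % N) % N      ≡⟨ cong (λ t → (m % N + t) % N) a≡b ⟩
  (m % N + b % N) % N      ≡⟨ %-distribˡ-+ m b N ⟨
  (m + b) % N              ∎
  where open ≡-Reasoning

shift-+ : ∀ {n} (x : Fin (suc n)) i j → shift (shift x i) j ≡ shift x (i ℤ.+ j)
shift-+ {n} x i j = toℕ-injective (begin
  toℕ (shift (shift x i) j)                          ≡⟨ toℕ-shift (shift x i) j ⟩
  (toℕ (shift x i) + residue n j) % N                ≡⟨ cong (λ t → (t + residue n j) % N) (toℕ-shift x i) ⟩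
  ((toℕ x + residue n i) % N + residue n j) % N      ≡⟨ %-+-congʳ ((toℕ x + residue n i) % N) N (m%n%n≡m%n (residue n j) N) ⟨
  ((toℕ x + residue n i) % N + residue n j % N) % N  ≡⟨ %-distribˡ-+ (toℕ x + residue n i) (residue n j) N ⟨
  (toℕ x + residue n i + residue n j) % N            ≡⟨ cong (_% N) (+-assoc (toℕ x) _ _) ⟩
  (toℕ x + (residue n i + residue n j)) % N          ≡⟨ %-+-congʳ (toℕ x) N (residue-+ n i j) ⟩
  (toℕ x + residue n (i ℤ.+ j)) % N                  ≡⟨ toℕ-shift x (i ℤ.+ j) ⟨
  toℕ (shift x (i ℤ.+ j))                            ∎)
  where
  open ≡-Reasoning
  N : ℕ
  N = suc n

shift-0 : ∀ {n} (x : Fin (suc n)) → shift x (+ 0) ≡ x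
shift-0 x = toℕ-injective (trans (toℕ-shift x (+ 0)) (trans (cong (_% _) (+-identityʳ (toℕ x))) (m<n⇒m%n≡m (toℕ<n x))))

shift-inverse : ∀ {n} (x : Fin (suc n)) i → shift (shift x (ℤ.- i)) i ≡ x
shift-inverse x i = trans (shift-+ x (ℤ.- i) i) (trans (cong (shift x) (ℤ.+-inverseˡ i)) (shift-0 x))

translation : ∀ {n} → ℤ → Permutation (suc n) (suc n)
translation i = permutation (λ x → shift x i) (λ x → shift x (ℤ.- i)) (λ x → shift-inverse x i)
  (λ x → trans (cong (λ j → shift (shift x j) (ℤ.- i)) (sym (ℤ.neg-involutive i))) (shift-inverse x (ℤ.- i)))

sum-shift : ∀ {n} (f : Fin (suc n) → ℕ) i → sum (λ x → f (shift x i)) ≡ sum f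
sum-shift f i = sym (∑-permute f (translation i))

∑²-shift : ∀ {m n} (F : Fin (suc m) → Fin (suc n) → ℕ) i j → ∑² (λ x y → F (shift x i) (shift y j)) ≡ ∑² F
∑²-shift F i j = trans (sum-cong-≗ λ x → sum-shift (F (shift x i)) j) (sum-shift (λ x → sum (F x)) i)

infixl 7 _·_

_·_ : ℤ → Fin 3 → ℤ
k · 0F = + 0
k · 1F = k
k · 2F = ℤ.- k

residue-· : ∀ n k v → residue n ((+ k) · v) ≡ k * dir n v
residue-· n k 0F = sym (*-zeroʳ k)
residue-· n k 1F = sym (*-identityʳ k)
residue-· n zero 2F = refl
residue-· n (suc k) 2F = refl

move≡shift : ∀ n (x : Fin (suc n)) v k → move n x v k ≡ shift x ((+ k) · v)
move≡shift n x v k = cong (λ r → (toℕ x + r) mod suc n) (sym (residue-· n k v))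

·-distribʳ-+ : ∀ i j v → (i ℤ.+ j) · v ≡ i · v ℤ.+ j · v
·-distribʳ-+ i j 0F = refl
·-distribʳ-+ i j 1F = refl
·-distribʳ-+ i j 2F = ℤ.neg-distrib-+ i j

neg : Fin 3 → Fin 3
neg 0F = 0F
neg 1F = 2F
neg 2F = 1F

neg² : ∀ v → neg (neg v) ≡ v
neg² 0F = refl
neg² 1F = refl
neg² 2F = refl

·-neg : ∀ v → (+ 1) · neg v ≡ ℤ.- ((+ 1) · v)
·-neg 0F = refl
·-neg 1F = refl
·-neg 2F = refl

0· : ∀ v → (+ 0) · v ≡ + 0
0· 0F = refl
0· 1F = refl
0· 2F = refl

neg-· : ∀ k v → (ℤ.- k) · v ≡ k · neg v
neg-· k 0F = refl
neg-· k 1F = refl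
neg-· k 2F = ℤ.neg-involutive k

-- Views and the discharging rules

data Letter : Set where
  𝐀 𝐁 𝐂 ∗ : Letter

_==_ : Letter → Letter → Bool
𝐀 == 𝐀 = true
𝐁 == 𝐁 = true
𝐂 == 𝐂 = true
∗ == ∗ = true
_ == _ = false

==-refl : ∀ l → T (l == l)
==-refl 𝐀 = tt
==-refl 𝐁 = tt
==-refl 𝐂 = tt
==-refl ∗ = tt

≡⇒T : ∀ {l m} → l ≡ m → T (l == m)
≡⇒T {l} refl = ==-refl l

T-== : ∀ {l m} → T (l == m) → l ≡ m
T-== {𝐀} {𝐀} _ = refl
T-== {𝐁} {𝐁} _ = refl
T-== {𝐂} {𝐂} _ = refl
T-== {∗} {∗} _ = refl
T-== {𝐀} {𝐁} ()
T-== {𝐀} {𝐂} ()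
T-== {𝐀} {∗} ()
T-== {𝐁} {𝐀} ()
T-== {𝐁} {𝐂} ()
T-== {𝐁} {∗} ()
T-== {𝐂} {𝐀} ()
T-== {𝐂} {𝐁} ()
T-== {𝐂} {∗} ()
T-== {∗} {𝐀} ()
T-== {∗} {𝐁} ()
T-== {∗} {𝐂} ()

-- A torus seen from one of its cells: letters by offset, with A, B, C renamed 𝐀, 𝐁, 𝐂 and
-- every other letter ∗.
View : Set
View = ℤ → ℤ → Letter

centre : View → Letter
centre V = V (+ 0) (+ 0)

at : View → ℤ → Fin 3 → Fin 3 → Letter
at V k v₁ v₂ = V (k · v₁) (k · v₂)

nb : View → Fin 3 → Fin 3 → Letter
nb V = at V (+ 1)

at-0 : ∀ V v₁ v₂ → at V (+ 0) v₁ v₂ ≡ centre V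
at-0 V v₁ v₂ = cong₂ V (0· v₁) (0· v₂)

at-neg : ∀ V k v₁ v₂ → at V (ℤ.- k) v₁ v₂ ≡ at V k (neg v₁) (neg v₂)
at-neg V k v₁ v₂ = cong₂ V (neg-· k v₁) (neg-· k v₂)

nb-neg² : ∀ V v₁ v₂ → nb V (neg (neg v₁)) (neg (neg v₂)) ≡ nb V v₁ v₂
nb-neg² V v₁ v₂ = cong₂ (nb V) (neg² v₁) (neg² v₂)

reads : View → ℤ → Fin 3 → Fin 3 → Bool
reads V s v₁ v₂ = allB λ i → at V (s ℤ.+ + toℕ i) v₁ v₂ == ABCC 𝐀 𝐁 𝐂 i

count : (Fin 3 → Fin 3 → Bool) → ℕ
count f = ∑² λ v₁ v₂ → 𝟙 (nonzero v₁ v₂ ∧ f v₁ v₂)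

-- Reading from -p · v puts the centre at position p of the word.
through : View → ℕ → ℕ
through V p = count (reads V (ℤ.- + p))

allB-cong : ∀ {ℓ} {f g : Fin ℓ → Bool} → (∀ i → f i ≡ g i) → allB f ≡ allB g
allB-cong {zero} f≗g = refl
allB-cong {suc ℓ} f≗g = cong₂ _∧_ (f≗g zero) (allB-cong (f≗g ∘ suc))

_≈_ : View → View → Set
V ≈ W = ∀ i j → V i j ≡ W i j

through-cong : ∀ {V W} → V ≈ W → ∀ p → through V p ≡ through W p
through-cong V≈W p = ∑²-cong λ v₁ v₂ →
  cong (λ t → 𝟙 (nonzero v₁ v₂ ∧ t)) (allB-cong λ i → cong (λ l → l == ABCC 𝐀 𝐁 𝐂 i) (V≈W (k i · v₁) (k i · v₂)))
  where
  k : Fin 4 → ℤ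
  k i = ℤ.- (+ p) ℤ.+ + toℕ i

translate : View → Fin 3 → Fin 3 → View
translate V v₁ v₂ i j = V ((+ 1) · v₁ ℤ.+ i) ((+ 1) · v₂ ℤ.+ j)

centre-translate : ∀ V u₁ u₂ → centre (translate V u₁ u₂) ≡ nb V u₁ u₂
centre-translate V u₁ u₂ = cong₂ V (ℤ.+-identityʳ _) (ℤ.+-identityʳ _)

rich𝐀 rich𝐁 rich𝐂 : View → Bool
rich𝐀 V = centre V == 𝐀 ∧ (7 ≤ᵇ through V 0)
rich𝐁 V = centre V == 𝐁 ∧ (4 ≤ᵇ through V 1)
rich𝐂 V = centre V == 𝐂 ∧ (4 ≤ᵇ through V 2)

claim : View → Letter → ℕ
claim V 𝐀 = 2 * 𝟙 (rich𝐁 V)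
claim V 𝐁 = 𝟙 (rich𝐀 V) + 2 * 𝟙 (rich𝐂 V)
claim V _ = 0

claim-cong : ∀ {V W} → V ≈ W → ∀ l → claim V l ≡ claim W l
claim-cong V≈W 𝐀 = cong (λ r → 2 * 𝟙 r) (cong₂ (λ c t → c == 𝐁 ∧ (4 ≤ᵇ t)) (V≈W _ _) (through-cong V≈W 1))
claim-cong V≈W 𝐁 = cong₂ (λ r r′ → 𝟙 r + 2 * 𝟙 r′)
  (cong₂ (λ c t → c == 𝐀 ∧ (7 ≤ᵇ t)) (V≈W _ _) (through-cong V≈W 0))
  (cong₂ (λ c t → c == 𝐂 ∧ (4 ≤ᵇ t)) (V≈W _ _) (through-cong V≈W 2))
claim-cong V≈W 𝐂 = refl
claim-cong V≈W ∗ = refl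

Σ⊕ : (Fin 3 → Fin 3 → ℕ) → ℕ
Σ⊕ f = f 1F 0F + f 2F 0F + f 0F 1F + f 0F 2F

load paid received : View → ℕ
load V = 2 * through V 0 + 4 * through V 1 + 4 * through V 2
paid V = Σ⊕ λ v₁ v₂ → claim (translate V v₁ v₂) (centre V)
received V = Σ⊕ λ v₁ v₂ → claim V (nb V v₁ v₂)

Σ⊕-cong : ∀ {f g} → (∀ v₁ v₂ → f v₁ v₂ ≡ g v₁ v₂) → Σ⊕ f ≡ Σ⊕ g
Σ⊕-cong f≗g = cong₂ _+_ (cong₂ _+_ (cong₂ _+_ (f≗g 1F 0F) (f≗g 2F 0F)) (f≗g 0F 1F)) (f≗g 0F 2F)

Σ⊕-neg : ∀ f → Σ⊕ (λ v₁ v₂ → f (neg v₁) (neg v₂)) ≡ Σ⊕ f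
Σ⊕-neg f = solve 4 (λ e w n s → w :+ e :+ s :+ n := e :+ w :+ n :+ s) refl (f 1F 0F) (f 2F 0F) (f 0F 1F) (f 0F 2F)
  where open ℕ-Solver.+-*-Solver

∑²-Σ⊕ : ∀ {m n} (F : Fin m → Fin n → Fin 3 → Fin 3 → ℕ) →
        ∑² (λ x y → Σ⊕ (F x y)) ≡ Σ⊕ (λ v₁ v₂ → ∑² λ x y → F x y v₁ v₂)
∑²-Σ⊕ {m} {n} F = begin
  ∑² (λ x y → f 1F 0F x y + f 2F 0F x y + f 0F 1F x y + f 0F 2F x y)
    ≡⟨ ∑²-distrib-+ (λ x y → f 1F 0F x y + f 2F 0F x y + f 0F 1F x y) (f 0F 2F) ⟩
  ∑² (λ x y → f 1F 0F x y + f 2F 0F x y + f 0F 1F x y) + ∑² (f 0F 2F)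
    ≡⟨ cong (_+ ∑² (f 0F 2F)) (∑²-distrib-+ (λ x y → f 1F 0F x y + f 2F 0F x y) (f 0F 1F)) ⟩
  ∑² (λ x y → f 1F 0F x y + f 2F 0F x y) + ∑² (f 0F 1F) + ∑² (f 0F 2F)
    ≡⟨ cong (λ t → t + ∑² (f 0F 1F) + ∑² (f 0F 2F)) (∑²-distrib-+ (f 1F 0F) (f 2F 0F)) ⟩
  ∑² (f 1F 0F) + ∑² (f 2F 0F) + ∑² (f 0F 1F) + ∑² (f 0F 2F) ∎
  where
  open ≡-Reasoning
  f : Fin 3 → Fin 3 → Fin m → Fin n → ℕ
  f v₁ v₂ x y = F x y v₁ v₂

module Grids {Σ : Set} (_≟_ : DecidableEquality Σ) (A B C : Σ) (A≢B : A ≢ B) (A≢C : A ≢ C) (B≢C : B ≢ C) where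

  letter : ∀ {z} → Dec (z ≡ A) → Dec (z ≡ B) → Dec (z ≡ C) → Letter
  letter (yes _) _ _ = 𝐀
  letter (no _) (yes _) _ = 𝐁
  letter (no _) (no _) (yes _) = 𝐂
  letter (no _) (no _) (no _) = ∗

  classify : Σ → Letter
  classify z = letter (z ≟ A) (z ≟ B) (z ≟ C)

  letter-𝐀 : ∀ {z} (a : Dec (z ≡ A)) b c → ⌊ a ⌋ ≡ (letter a b c == 𝐀)
  letter-𝐀 (yes _) _ _ = refl
  letter-𝐀 (no _) (yes _) _ = refl
  letter-𝐀 (no _) (no _) (yes _) = refl
  letter-𝐀 (no _) (no _) (no _) = refl

  letter-𝐁 : ∀ {z} (a : Dec (z ≡ A)) b c → ⌊ b ⌋ ≡ (letter a b c == 𝐁)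
  letter-𝐁 (yes z≡A) (yes z≡B) _ = ⊥-elim (A≢B (trans (sym z≡A) z≡B))
  letter-𝐁 (yes _) (no _) _ = refl
  letter-𝐁 (no _) (yes _) _ = refl
  letter-𝐁 (no _) (no _) (yes _) = refl
  letter-𝐁 (no _) (no _) (no _) = refl

  letter-𝐂 : ∀ {z} (a : Dec (z ≡ A)) b c → ⌊ c ⌋ ≡ (letter a b c == 𝐂)
  letter-𝐂 (yes z≡A) _ (yes z≡C) = ⊥-elim (A≢C (trans (sym z≡A) z≡C))
  letter-𝐂 (yes _) _ (no _) = refl
  letter-𝐂 (no _) (yes z≡B) (yes z≡C) = ⊥-elim (B≢C (trans (sym z≡B) z≡C))
  letter-𝐂 (no _) (yes _) (no _) = refl
  letter-𝐂 (no _) (no _) (yes _) = refl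
  letter-𝐂 (no _) (no _) (no _) = refl

  classify-correct : ∀ z i → ⌊ z ≟ ABCC A B C i ⌋ ≡ (classify z == ABCC 𝐀 𝐁 𝐂 i)
  classify-correct z zero = letter-𝐀 (z ≟ A) (z ≟ B) (z ≟ C)
  classify-correct z (suc zero) = letter-𝐁 (z ≟ A) (z ≟ B) (z ≟ C)
  classify-correct z (suc (suc zero)) = letter-𝐂 (z ≟ A) (z ≟ B) (z ≟ C)
  classify-correct z (suc (suc (suc zero))) = letter-𝐂 (z ≟ A) (z ≟ B) (z ≟ C)

  module _ (g : Grid2 Σ) where

    view : Fin (suc (a g)) → Fin (suc (b g)) → View
    view x y i j = classify (Γ g (shift x i) (shift y j))

    move-shift : ∀ {n} (x : Fin (suc n)) s v k → move n (shift x (s · v)) v k ≡ shift x ((s ℤ.+ + k) · v)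
    move-shift {n} x s v k = begin
      move n (shift x (s · v)) v k          ≡⟨ move≡shift n (shift x (s · v)) v k ⟩
      shift (shift x (s · v)) ((+ k) · v)   ≡⟨ shift-+ x (s · v) ((+ k) · v) ⟩
      shift x (s · v ℤ.+ (+ k) · v)         ≡⟨ cong (shift x) (·-distribʳ-+ s (+ k) v) ⟨
      shift x ((s ℤ.+ + k) · v)             ∎
      where open ≡-Reasoning

    isAppearance≡reads : ∀ x y s v₁ v₂ →
      isAppearance _≟_ (ABCC A B C) g (shift x (s · v₁)) (shift y (s · v₂)) v₁ v₂ ≡ reads (view x y) s v₁ v₂
    isAppearance≡reads x y s v₁ v₂ = allB-cong λ i → trans
      (cong (λ z → ⌊ z ≟ ABCC A B C i ⌋) (cong₂ (Γ g) (move-shift x s v₁ (toℕ i)) (move-shift y s v₂ (toℕ i))))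
      (classify-correct _ i)

    ∑-through : ∀ p → ∑² (λ x y → through (view x y) p) ≡ appearances _≟_ (ABCC A B C) g
    ∑-through p = begin
      ∑² (λ x y → ∑² λ v₁ v₂ → 𝟙 (nonzero v₁ v₂ ∧ reads (view x y) s v₁ v₂))
        ≡⟨ ∑²-comm (λ x y v₁ v₂ → 𝟙 (nonzero v₁ v₂ ∧ reads (view x y) s v₁ v₂)) ⟩
      ∑² (λ v₁ v₂ → ∑² λ x y → 𝟙 (nonzero v₁ v₂ ∧ reads (view x y) s v₁ v₂))
        ≡⟨ ∑²-cong (λ v₁ v₂ → ∑²-cong λ x y → cong (λ t → 𝟙 (nonzero v₁ v₂ ∧ t)) (isAppearance≡reads x y s v₁ v₂)) ⟨
      ∑² (λ v₁ v₂ → ∑² λ x y → 𝟙 (nonzero v₁ v₂ ∧ app (shift x (s · v₁)) (shift y (s · v₂)) v₁ v₂))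
        ≡⟨ ∑²-cong (λ v₁ v₂ → ∑²-shift (λ x y → 𝟙 (nonzero v₁ v₂ ∧ app x y v₁ v₂)) (s · v₁) (s · v₂)) ⟩
      ∑² (λ v₁ v₂ → ∑² λ x y → 𝟙 (nonzero v₁ v₂ ∧ app x y v₁ v₂))
        ≡⟨ ∑²-comm (λ x y v₁ v₂ → 𝟙 (nonzero v₁ v₂ ∧ app x y v₁ v₂)) ⟨
      ∑² (λ x y → ∑² λ v₁ v₂ → 𝟙 (nonzero v₁ v₂ ∧ app x y v₁ v₂))
        ≡⟨ appearances≡∑² _≟_ (ABCC A B C) g ⟨
      appearances _≟_ (ABCC A B C) g ∎
      where
      open ≡-Reasoning
      s : ℤ
      s = ℤ.- + p
      app : Fin (suc (a g)) → Fin (suc (b g)) → Fin 3 → Fin 3 → Bool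
      app = isAppearance _≟_ (ABCC A B C) g

    translate-view : ∀ x y v₁ v₂ → translate (view x y) v₁ v₂ ≈ view (shift x ((+ 1) · v₁)) (shift y ((+ 1) · v₂))
    translate-view x y v₁ v₂ i j = sym (cong₂ (λ x′ y′ → classify (Γ g x′ y′)) (shift-+ x ((+ 1) · v₁) i) (shift-+ y ((+ 1) · v₂) j))

    -- What the cells pay towards v is what they receive from -v.
    ∑-paid-towards : ∀ v₁ v₂ → ∑² (λ x y → claim (translate (view x y) v₁ v₂) (centre (view x y)))
                             ≡ ∑² (λ x y → claim (view x y) (nb (view x y) (neg v₁) (neg v₂)))
    ∑-paid-towards v₁ v₂ = begin
      ∑² (λ x y → claim (translate (view x y) v₁ v₂) (centre (view x y)))
        ≡⟨ ∑²-cong (λ x y → claim-cong (translate-view x y v₁ v₂) (centre (view x y))) ⟩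
      ∑² (λ x y → claim (view (shift x e₁) (shift y e₂)) (centre (view x y)))
        ≡⟨ ∑²-shift (λ x y → claim (view (shift x e₁) (shift y e₂)) (centre (view x y))) (ℤ.- e₁) (ℤ.- e₂) ⟨
      ∑² (λ x y → claim (view (shift (shift x (ℤ.- e₁)) e₁) (shift (shift y (ℤ.- e₂)) e₂)) (centre (view (shift x (ℤ.- e₁)) (shift y (ℤ.- e₂)))))
        ≡⟨ ∑²-cong (λ x y → cong₂ claim (cong₂ view (shift-inverse x e₁) (shift-inverse y e₂))
                                         (cong₂ (λ x′ y′ → classify (Γ g x′ y′)) (behind x v₁) (behind y v₂))) ⟩
      ∑² (λ x y → claim (view x y) (nb (view x y) (neg v₁) (neg v₂))) ∎
      where
      open ≡-Reasoning
      e₁ e₂ : ℤ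
      e₁ = (+ 1) · v₁
      e₂ = (+ 1) · v₂
      behind : ∀ {n} (x : Fin (suc n)) v → shift (shift x (ℤ.- ((+ 1) · v))) (+ 0) ≡ shift x ((+ 1) · neg v)
      behind x v = trans (shift-0 _) (cong (shift x) (sym (·-neg v)))

    ∑-paid≡∑-received : ∑² (λ x y → paid (view x y)) ≡ ∑² (λ x y → received (view x y))
    ∑-paid≡∑-received = begin
      ∑² (λ x y → paid (view x y))
        ≡⟨ ∑²-Σ⊕ (λ x y v₁ v₂ → claim (translate (view x y) v₁ v₂) (centre (view x y))) ⟩
      Σ⊕ (λ v₁ v₂ → ∑² λ x y → claim (translate (view x y) v₁ v₂) (centre (view x y)))
        ≡⟨ Σ⊕-cong ∑-paid-towards ⟩
      Σ⊕ (λ v₁ v₂ → ∑² λ x y → claim (view x y) (nb (view x y) (neg v₁) (neg v₂)))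
        ≡⟨ Σ⊕-neg (λ v₁ v₂ → ∑² λ x y → claim (view x y) (nb (view x y) v₁ v₂)) ⟩
      Σ⊕ (λ v₁ v₂ → ∑² λ x y → claim (view x y) (nb (view x y) v₁ v₂))
        ≡⟨ ∑²-Σ⊕ (λ x y v₁ v₂ → claim (view x y) (nb (view x y) v₁ v₂)) ⟨
      ∑² (λ x y → received (view x y)) ∎
      where open ≡-Reasoning

    ∑-load : ∑² (λ x y → load (view x y)) ≡ 10 * appearances _≟_ (ABCC A B C) g
    ∑-load = begin
      ∑² (λ x y → 2 * T₀ x y + 4 * T₁ x y + 4 * T₂ x y)
        ≡⟨ ∑²-distrib-+ (λ x y → 2 * T₀ x y + 4 * T₁ x y) (λ x y → 4 * T₂ x y) ⟩
      ∑² (λ x y → 2 * T₀ x y + 4 * T₁ x y) + ∑² (λ x y → 4 * T₂ x y)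
        ≡⟨ cong₂ _+_ (∑²-distrib-+ (λ x y → 2 * T₀ x y) (λ x y → 4 * T₁ x y)) refl ⟩
      ∑² (λ x y → 2 * T₀ x y) + ∑² (λ x y → 4 * T₁ x y) + ∑² (λ x y → 4 * T₂ x y)
        ≡⟨ cong₂ _+_ (cong₂ _+_ (∑²-*ˡ 2 T₀) (∑²-*ˡ 4 T₁)) (∑²-*ˡ 4 T₂) ⟩
      2 * ∑² T₀ + 4 * ∑² T₁ + 4 * ∑² T₂
        ≡⟨ cong₂ _+_ (cong₂ _+_ (cong (2 *_) (∑-through 0)) (cong (4 *_) (∑-through 1))) (cong (4 *_) (∑-through 2)) ⟩
      2 * N + 4 * N + 4 * N
        ≡⟨ solve 1 (λ N → con 2 :* N :+ con 4 :* N :+ con 4 :* N := con 10 :* N) refl N ⟩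
      10 * N ∎
      where
      open ≡-Reasoning
      open ℕ-Solver.+-*-Solver
      N : ℕ
      N = appearances _≟_ (ABCC A B C) g
      T₀ T₁ T₂ : Fin (suc (a g)) → Fin (suc (b g)) → ℕ
      T₀ x y = through (view x y) 0
      T₁ x y = through (view x y) 1
      T₂ x y = through (view x y) 2

    discharging : (∀ V → load V + paid V ≤ 12 + received V) → 5 * appearances _≟_ (ABCC A B C) g ≤ 6 * size g
    discharging local = *-cancelˡ-≤ 2 (begin
      2 * (5 * N)                                  ≡⟨ *-assoc 2 5 N ⟨
      10 * N                                       ≤⟨ +-cancelʳ-≤ P (10 * N) (12 * size g) total ⟩
      12 * size g                                  ≡⟨ *-assoc 2 6 (size g) ⟩
      2 * (6 * size g)                             ∎)
      where
      open ≤-Reasoning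
      N P : ℕ
      N = appearances _≟_ (ABCC A B C) g
      P = ∑² (λ x y → paid (view x y))
      total : 10 * N + P ≤ 12 * size g + P
      total = begin
        10 * N + P                                              ≡⟨ cong (_+ P) ∑-load ⟨
        ∑² (λ x y → load (view x y)) + P                        ≡⟨ ∑²-distrib-+ (λ x y → load (view x y)) (λ x y → paid (view x y)) ⟨
        ∑² (λ x y → load (view x y) + paid (view x y))          ≤⟨ ∑²-mono-≤ (λ x y → local (view x y)) ⟩
        ∑² (λ x y → 12 + received (view x y))                   ≡⟨ ∑²-distrib-+ {suc (a g)} {suc (b g)} (λ _ _ → 12) (λ x y → received (view x y)) ⟩
        ∑² {suc (a g)} {suc (b g)} (λ _ _ → 12) + ∑² (λ x y → received (view x y))
          ≡⟨ cong₂ _+_ (trans (∑²-const (suc (a g)) (suc (b g)) 12) (*-comm (size g) 12)) (sym ∑-paid≡∑-received) ⟩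
        12 * size g + P                                         ∎

∧-elim : ∀ {a b} → T (a ∧ b) → T a × T b
∧-elim {true} t = tt , t

∧-intro : ∀ {a b} → T a → T b → T (a ∧ b)
∧-intro {true} _ t = t

∨-elim : ∀ {a b} {C : Set} → T (a ∨ b) → (T a → C) → (T b → C) → C
∨-elim {true} t f g = f tt
∨-elim {false} t f g = g t

∨-introˡ : ∀ {a b} → T a → T (a ∨ b)
∨-introˡ {true} _ = tt

∨-introʳ : ∀ {a b} → T b → T (a ∨ b)
∨-introʳ {true} _ = tt
∨-introʳ {false} t = t

∨-swap : ∀ {a b} → T (a ∨ b) → T (b ∨ a)
∨-swap {true} {true} _ = tt
∨-swap {true} {false} _ = tt
∨-swap {false} {true} _ = tt

not-intro : ∀ {a} → (T a → ⊥) → T (not a)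
not-intro {false} _ = tt
not-intro {true} f = f tt

not-elim : ∀ {a} → T (not a) → T a → ⊥
not-elim {false} _ ()

nor : ∀ {a b} → T (not a) → T (not b) → T (not (a ∨ b))
nor {false} {false} _ _ = tt

infixr 4 _⇒_

_⇒_ : Bool → Bool → Bool
a ⇒ b = not a ∨ b

⇒-intro : ∀ {a b} → (T a → T b) → T (a ⇒ b)
⇒-intro {false} f = tt
⇒-intro {true} f = f tt

⇒-elim : ∀ {a b} → T (a ⇒ b) → T a → T b
⇒-elim {true} t _ = t

𝟙-mono : ∀ {a b} → (T a → T b) → 𝟙 a ≤ 𝟙 b
𝟙-mono {false} _ = z≤n
𝟙-mono {true} f with f tt
𝟙-mono {true} {true} f | _ = ≤-refl

𝟙-false : ∀ {a} → (T a → ⊥) → 𝟙 a ≡ 0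
𝟙-false {false} _ = refl
𝟙-false {true} f = ⊥-elim (f tt)

𝟙-true : ∀ {b} → T b → 𝟙 b ≡ 1
𝟙-true {true} _ = refl

∀ᵇ : ∀ n → (Vec Bool n → Bool) → Bool
∀ᵇ zero P = P []
∀ᵇ (suc n) P = ∀ᵇ n (λ bs → P (true ∷ bs)) ∧ ∀ᵇ n (λ bs → P (false ∷ bs))

∀ᵇ-sound : ∀ n P → T (∀ᵇ n P) → ∀ bs → T (P bs)
∀ᵇ-sound zero P t [] = t
∀ᵇ-sound (suc n) P t (true ∷ bs) = ∀ᵇ-sound n _ (proj₁ (∧-elim t)) bs
∀ᵇ-sound (suc n) P t (false ∷ bs) = ∀ᵇ-sound n _ (proj₂ (∧-elim {∀ᵇ n (λ bs → P (true ∷ bs))} t)) bs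

∀≤ᵇ : ℕ → (ℕ → Bool) → Bool
∀≤ᵇ zero Q = Q 0
∀≤ᵇ (suc n) Q = Q 0 ∧ ∀≤ᵇ n (λ m → Q (suc m))

∀≤ᵇ-sound : ∀ n Q → T (∀≤ᵇ n Q) → ∀ m → m ≤ n → T (Q m)
∀≤ᵇ-sound zero Q t zero z≤n = t
∀≤ᵇ-sound (suc n) Q t zero z≤n = proj₁ (∧-elim t)
∀≤ᵇ-sound (suc n) Q t (suc m) (s≤s m≤n) = ∀≤ᵇ-sound n _ (proj₂ (∧-elim {Q 0} t)) m m≤n

bits⁸ : (Fin 3 → Fin 3 → Bool) → Vec Bool 8
bits⁸ f = f 0F 1F ∷ f 0F 2F ∷ f 1F 0F ∷ f 1F 1F ∷ f 1F 2F ∷ f 2F 0F ∷ f 2F 1F ∷ f 2F 2F ∷ []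

from-bits⁸ : Vec Bool 8 → Fin 3 → Fin 3 → Bool
from-bits⁸ (b₀₁ ∷ b₀₂ ∷ b₁₀ ∷ b₁₁ ∷ b₁₂ ∷ b₂₀ ∷ b₂₁ ∷ b₂₂ ∷ []) = λ where
  0F 0F → false
  0F 1F → b₀₁
  0F 2F → b₀₂
  1F 0F → b₁₀
  1F 1F → b₁₁
  1F 2F → b₁₂
  2F 0F → b₂₀
  2F 1F → b₂₁
  2F 2F → b₂₂

-- A Boolean property of the eight neighbours is checked on all 2⁸ patterns; it then holds
-- for f because from-bits⁸ (bits⁸ f) agrees with f on the eight neighbours by evaluation.
decide⁸ : (Φ : (Fin 3 → Fin 3 → Bool) → Bool) → T (∀ᵇ 8 (λ bs → Φ (from-bits⁸ bs))) → ∀ f → T (Φ (from-bits⁸ (bits⁸ f)))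
decide⁸ Φ t f = ∀ᵇ-sound 8 (λ bs → Φ (from-bits⁸ bs)) t (bits⁸ f)

from-bits⁴ : Vec Bool 4 → Fin 3 → Fin 3 → Bool
from-bits⁴ (e ∷ w ∷ n ∷ s ∷ []) = λ where
  1F 0F → e
  2F 0F → w
  0F 1F → n
  0F 2F → s
  _ _ → false

bits⁴ : (Fin 3 → Fin 3 → Bool) → Vec Bool 4
bits⁴ f = f 1F 0F ∷ f 2F 0F ∷ f 0F 1F ∷ f 0F 2F ∷ []

decide⁴⁸ : (Φ : (Fin 3 → Fin 3 → Bool) → (Fin 3 → Fin 3 → Bool) → Bool) →
           T (∀ᵇ 4 λ os → ∀ᵇ 8 λ bs → Φ (from-bits⁴ os) (from-bits⁸ bs)) → ∀ o b → T (Φ (from-bits⁴ (bits⁴ o)) (from-bits⁸ (bits⁸ b)))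
decide⁴⁸ Φ t o b = ∀ᵇ-sound 8 (λ bs → Φ (from-bits⁴ (bits⁴ o)) (from-bits⁸ bs))
  (∀ᵇ-sound 4 (λ os → ∀ᵇ 8 λ bs → Φ (from-bits⁴ os) (from-bits⁸ bs)) t (bits⁴ o)) (bits⁸ b)

decide⁴⁴ : (Φ : (Fin 3 → Fin 3 → Bool) → (Fin 3 → Fin 3 → Bool) → Bool) →
           T (∀ᵇ 4 λ os → ∀ᵇ 4 λ ps → Φ (from-bits⁴ os) (from-bits⁴ ps)) → ∀ o p → T (Φ (from-bits⁴ (bits⁴ o)) (from-bits⁴ (bits⁴ p)))
decide⁴⁴ Φ t o p = ∀ᵇ-sound 4 (λ ps → Φ (from-bits⁴ (bits⁴ o)) (from-bits⁴ ps))
  (∀ᵇ-sound 4 (λ os → ∀ᵇ 4 λ ps → Φ (from-bits⁴ os) (from-bits⁴ ps)) t (bits⁴ o)) (bits⁴ p)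

-- Appearances through and around the centre

role₀ : ∀ V v₁ v₂ → T (reads V (+ 0) v₁ v₂) → centre V ≡ 𝐀 × nb V v₁ v₂ ≡ 𝐁
role₀ V v₁ v₂ t with ∧-elim t
... | t₀ , t₁₂₃ = trans (sym (at-0 V v₁ v₂)) (T-== t₀) , T-== (proj₁ (∧-elim t₁₂₃))

role₁ : ∀ V v₁ v₂ → T (reads V (ℤ.- + 1) v₁ v₂) → nb V (neg v₁) (neg v₂) ≡ 𝐀 × centre V ≡ 𝐁 × nb V v₁ v₂ ≡ 𝐂
role₁ V v₁ v₂ t with ∧-elim t
... | t₀ , t₁₂₃ with ∧-elim t₁₂₃
... | t₁ , t₂₃ = trans (sym (at-neg V (+ 1) v₁ v₂)) (T-== t₀) , trans (sym (at-0 V v₁ v₂)) (T-== t₁) , T-== (proj₁ (∧-elim t₂₃))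

role₂ : ∀ V v₁ v₂ → T (reads V (ℤ.- + 2) v₁ v₂) →
        at V (+ 2) (neg v₁) (neg v₂) ≡ 𝐀 × nb V (neg v₁) (neg v₂) ≡ 𝐁 × centre V ≡ 𝐂 × nb V v₁ v₂ ≡ 𝐂
role₂ V v₁ v₂ t with ∧-elim t
... | t₀ , t₁₂₃ with ∧-elim t₁₂₃
... | t₁ , t₂₃ with ∧-elim t₂₃
... | t₂ , t₃ = trans (sym (at-neg V (+ 2) v₁ v₂)) (T-== t₀) , trans (sym (at-neg V (+ 1) v₁ v₂)) (T-== t₁) ,
                trans (sym (at-0 V v₁ v₂)) (T-== t₂) , T-== (proj₁ (∧-elim t₃))

count-mono : ∀ {f g} → (∀ v₁ v₂ → T (f v₁ v₂) → T (g v₁ v₂)) → count f ≤ count g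
count-mono {f} {g} f⇒g = ∑²-mono-≤ λ v₁ v₂ → 𝟙-mono {nonzero v₁ v₂ ∧ f v₁ v₂} {nonzero v₁ v₂ ∧ g v₁ v₂}
  λ t → ∧-intro (proj₁ (∧-elim t)) (f⇒g v₁ v₂ (proj₂ (∧-elim {nonzero v₁ v₂} t)))

count-none : ∀ {f} → (∀ v₁ v₂ → T (f v₁ v₂) → ⊥) → count f ≡ 0
count-none {f} ¬f = trans (∑²-cong λ v₁ v₂ → 𝟙-false λ t → ¬f v₁ v₂ (proj₂ (∧-elim {nonzero v₁ v₂} t))) (∑²-const 3 3 0)

Antipodal-free : (Fin 3 → Fin 3 → Bool) → Set
Antipodal-free f = ∀ v₁ v₂ → T (f v₁ v₂) → T (f (neg v₁) (neg v₂)) → ⊥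

occupied : (Fin 3 → Fin 3 → Bool) → Fin 3 → Fin 3 → Bool
occupied f v₁ v₂ = f v₁ v₂ ∨ f (neg v₁) (neg v₂)

occupied-neg : ∀ f v₁ v₂ → T (occupied f v₁ v₂) → T (occupied f (neg v₁) (neg v₂))
occupied-neg f v₁ v₂ t = subst (λ x → T (f (neg v₁) (neg v₂) ∨ x)) (sym (cong₂ f (neg² v₁) (neg² v₂))) (∨-swap {f v₁ v₂} t)

exclusive-on-axes full-axes : (Fin 3 → Fin 3 → Bool) → Bool
exclusive-on-axes f = not (f 1F 0F ∧ f 2F 0F) ∧ not (f 0F 1F ∧ f 0F 2F) ∧ not (f 1F 1F ∧ f 2F 2F) ∧ not (f 1F 2F ∧ f 2F 1F)
full-axes f = occupied f 1F 0F ∧ occupied f 0F 1F ∧ occupied f 1F 1F ∧ occupied f 1F 2F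

antipodal-counting : ∀ f → T (exclusive-on-axes f ⇒ (count f ≤ᵇ 4) ∧ ((4 ≤ᵇ count f) ⇒ full-axes f))
antipodal-counting = decide⁸ (λ f → exclusive-on-axes f ⇒ (count f ≤ᵇ 4) ∧ ((4 ≤ᵇ count f) ⇒ full-axes f)) tt

exclusive-on-axes-intro : ∀ {f} → Antipodal-free f → T (exclusive-on-axes f)
exclusive-on-axes-intro {f} free = ∧-intro (excl 1F 0F) (∧-intro (excl 0F 1F) (∧-intro (excl 1F 1F) (excl 1F 2F)))
  where
  excl : ∀ v₁ v₂ → T (not (f v₁ v₂ ∧ f (neg v₁) (neg v₂)))
  excl v₁ v₂ = not-intro λ t → let t₁ , t₂ = ∧-elim {f v₁ v₂} t in free v₁ v₂ t₁ t₂

full-axes-elim : ∀ {f} → T (full-axes f) → ∀ v₁ v₂ → T (nonzero v₁ v₂) → T (occupied f v₁ v₂)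
full-axes-elim {f} t v₁ v₂ nz with ∧-elim t
... | h , t′ with ∧-elim t′
... | v , t″ with ∧-elim t″
... | d , e = on v₁ v₂ nz
  where
  on : ∀ v₁ v₂ → T (nonzero v₁ v₂) → T (occupied f v₁ v₂)
  on 0F 1F _ = v
  on 0F 2F _ = occupied-neg f 0F 1F v
  on 1F 0F _ = h
  on 1F 1F _ = d
  on 1F 2F _ = e
  on 2F 0F _ = occupied-neg f 1F 0F h
  on 2F 1F _ = occupied-neg f 1F 2F e
  on 2F 2F _ = occupied-neg f 1F 1F d

count-≤4 : ∀ {f} → Antipodal-free f → count f ≤ 4
count-≤4 {f} free = ≤ᵇ⇒≤ (count f) 4 (proj₁ (∧-elim (⇒-elim (antipodal-counting f) (exclusive-on-axes-intro free))))

all-axes-occupied : ∀ {f} → Antipodal-free f → 4 ≤ count f → ∀ v₁ v₂ → T (nonzero v₁ v₂) → T (occupied f v₁ v₂)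
all-axes-occupied {f} free 4≤ =
  full-axes-elim {f} (⇒-elim (proj₂ (∧-elim {count f ≤ᵇ 4} (⇒-elim (antipodal-counting f) (exclusive-on-axes-intro free)))) (≤⇒≤ᵇ 4≤))

role₁-free : ∀ W → Antipodal-free (reads W (ℤ.- + 1))
role₁-free W v₁ v₂ r r′ with trans (sym (nb-neg² W v₁ v₂)) (proj₁ (role₁ W (neg v₁) (neg v₂) r′)) | proj₂ (proj₂ (role₁ W v₁ v₂ r))
... | 𝐀≡ | 𝐂≡ with trans (sym 𝐀≡) 𝐂≡
... | ()

role₂-free : ∀ W → Antipodal-free (reads W (ℤ.- + 2))
role₂-free W v₁ v₂ r r′ with trans (sym (nb-neg² W v₁ v₂)) (proj₁ (proj₂ (role₂ W (neg v₁) (neg v₂) r′))) | proj₂ (proj₂ (proj₂ (role₂ W v₁ v₂ r)))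
... | 𝐁≡ | 𝐂≡ with trans (sym 𝐁≡) 𝐂≡
... | ()

All⊕ : (Fin 3 → Fin 3 → Set) → Set
All⊕ P = P 1F 0F × P 2F 0F × P 0F 1F × P 0F 2F

All⊕-map : ∀ {P Q : Fin 3 → Fin 3 → Set} → (∀ {u₁ u₂} → P u₁ u₂ → Q u₁ u₂) → All⊕ P → All⊕ Q
All⊕-map f (e , w , n , s) = f e , f w , f n , f s

all⊕ : ∀ {P : Fin 3 → Fin 3 → Set} → (∀ u₁ u₂ → P u₁ u₂) → All⊕ P
all⊕ p = p 1F 0F , p 2F 0F , p 0F 1F , p 0F 2F

every⊕ : (Fin 3 → Fin 3 → Bool) → Bool
every⊕ φ = φ 1F 0F ∧ φ 2F 0F ∧ φ 0F 1F ∧ φ 0F 2F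

every⊕-intro : ∀ {φ} → All⊕ (λ u₁ u₂ → T (φ u₁ u₂)) → T (every⊕ φ)
every⊕-intro (e , w , n , s) = ∧-intro e (∧-intro w (∧-intro n s))

every⊕-elim : ∀ {φ} → T (every⊕ φ) → All⊕ (λ u₁ u₂ → T (φ u₁ u₂))
every⊕-elim {φ} t with ∧-elim t
... | e , t′ with ∧-elim t′
... | w , t″ with ∧-elim t″
... | n , s = e , w , n , s

Σ⊕-mono-≤ : ∀ {f g} → All⊕ (λ u₁ u₂ → f u₁ u₂ ≤ g u₁ u₂) → Σ⊕ f ≤ Σ⊕ g
Σ⊕-mono-≤ (e , w , n , s) = +-mono-≤ (+-mono-≤ (+-mono-≤ e w) n) s

-- For an orthogonal direction u (horizontal iff u₂ is 0F): the two orthogonal neighbours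
-- of the centre perpendicular to u, and the two diagonal neighbours next to u.
sides corners : (Bool → Bool → Bool) → (Fin 3 → Fin 3 → Bool) → Fin 3 → Fin 3 → Bool
sides φ f u₁ 0F = φ (f 0F 1F) (f 0F 2F)
sides φ f u₁ (suc u₂) = φ (f 1F 0F) (f 2F 0F)
corners φ f u₁ 0F = φ (f u₁ 1F) (f u₁ 2F)
corners φ f u₁ (suc u₂) = φ (f 1F (suc u₂)) (f 2F (suc u₂))

is : Letter → View → Fin 3 → Fin 3 → Bool
is l V v₁ v₂ = nb V v₁ v₂ == l

is-not : ∀ V v₁ v₂ {l m} → nb V v₁ v₂ ≡ l → T (not (l == m)) → T (not (is m V v₁ v₂))
is-not V v₁ v₂ {m = m} eq t = subst (λ x → T (not (x == m))) (sym eq) t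

seven⇒flanks : ∀ f → T ((7 ≤ᵇ count f) ⇒ every⊕ (λ u₁ u₂ → sides _∨_ f u₁ u₂ ∧ corners _∨_ f u₁ u₂))
seven⇒flanks = decide⁸ (λ f → (7 ≤ᵇ count f) ⇒ every⊕ (λ u₁ u₂ → sides _∨_ f u₁ u₂ ∧ corners _∨_ f u₁ u₂)) tt

rich𝐀-flanks : ∀ W → T (rich𝐀 W) →
  centre W ≡ 𝐀 × All⊕ (λ u₁ u₂ → T (sides _∨_ (is 𝐁 W) u₁ u₂ ∧ corners _∨_ (is 𝐁 W) u₁ u₂))
rich𝐀-flanks W t with ∧-elim t
... | c , t₇ = T-== c , every⊕-elim {λ u₁ u₂ → sides _∨_ (is 𝐁 W) u₁ u₂ ∧ corners _∨_ (is 𝐁 W) u₁ u₂}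
  (⇒-elim (seven⇒flanks (is 𝐁 W)) (≤⇒≤ᵇ (≤-trans (≤ᵇ⇒≤ 7 _ t₇) (count-mono λ v₁ v₂ r → ≡⇒T (proj₂ (role₀ W v₁ v₂ r))))))

rich𝐁-ring : ∀ W → T (rich𝐁 W) → centre W ≡ 𝐁 × (∀ w₁ w₂ → T (nonzero w₁ w₂) → T (not (is 𝐁 W w₁ w₂)))
rich𝐁-ring W t with ∧-elim t
... | c , t₄ = T-== c , λ w₁ w₂ nz → ∨-elim (all-axes-occupied (role₁-free W) (≤ᵇ⇒≤ 4 _ t₄) w₁ w₂ nz)
  (λ r → is-not W w₁ w₂ (proj₂ (proj₂ (role₁ W w₁ w₂ r))) tt)
  (λ r → is-not W w₁ w₂ (trans (sym (nb-neg² W w₁ w₂)) (proj₁ (role₁ W (neg w₁) (neg w₂) r))) tt)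

module Rich𝐂 (W : View) (t : T (rich𝐂 W)) where

  centre≡𝐂 : centre W ≡ 𝐂
  centre≡𝐂 = T-== (proj₁ (∧-elim t))

  axes : ∀ w₁ w₂ → T (nonzero w₁ w₂) → T (occupied (reads W (ℤ.- + 2)) w₁ w₂)
  axes = all-axes-occupied (role₂-free W) (≤ᵇ⇒≤ 4 _ (proj₂ (∧-elim {centre W == 𝐂} t)))

  ring-not-𝐀 : ∀ w₁ w₂ → T (nonzero w₁ w₂) → T (not (is 𝐀 W w₁ w₂))
  ring-not-𝐀 w₁ w₂ nz = ∨-elim (axes w₁ w₂ nz)
    (λ r → is-not W w₁ w₂ (proj₂ (proj₂ (proj₂ (role₂ W w₁ w₂ r)))) tt)
    (λ r → is-not W w₁ w₂ (trans (sym (nb-neg² W w₁ w₂)) (proj₁ (proj₂ (role₂ W (neg w₁) (neg w₂) r)))) tt)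

  axis-𝐁 : ∀ w₁ w₂ → T (nonzero w₁ w₂) → T (is 𝐁 W w₁ w₂ ∨ is 𝐁 W (neg w₁) (neg w₂))
  axis-𝐁 w₁ w₂ nz = ∨-elim (axes w₁ w₂ nz)
    (λ r → ∨-introʳ {is 𝐁 W w₁ w₂} (≡⇒T (proj₁ (proj₂ (role₂ W w₁ w₂ r)))))
    (λ r → ∨-introˡ (≡⇒T (trans (sym (nb-neg² W w₁ w₂)) (proj₁ (proj₂ (role₂ W (neg w₁) (neg w₂) r))))))

  behind : ∀ w₁ w₂ → T (nonzero w₁ w₂) → nb W (neg w₁) (neg w₂) ≡ 𝐁 → at W (+ 2) (neg w₁) (neg w₂) ≡ 𝐀
  behind w₁ w₂ nz b = ∨-elim (axes w₁ w₂ nz)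
    (λ r → proj₁ (role₂ W w₁ w₂ r))
    (λ r → ⊥-elim (𝐁≢𝐂 (trans (sym b) (proj₂ (proj₂ (proj₂ (role₂ W (neg w₁) (neg w₂) r)))))))
    where
    𝐁≢𝐂 : 𝐁 ≢ 𝐂
    𝐁≢𝐂 ()

-- The local inequality

≡-≢ : ∀ {A : Set} {x y z : A} → x ≡ y → y ≢ z → x ≢ z
≡-≢ x≡y y≢z x≡z = y≢z (trans (sym x≡y) x≡z)

absent-𝐀 : ∀ V → centre V ≢ 𝐀 → through V 0 ≡ 0
absent-𝐀 V c≢𝐀 = count-none λ v₁ v₂ r → c≢𝐀 (proj₁ (role₀ V v₁ v₂ r))

absent-𝐁 : ∀ V → centre V ≢ 𝐁 → through V 1 ≡ 0
absent-𝐁 V c≢𝐁 = count-none λ v₁ v₂ r → c≢𝐁 (proj₁ (proj₂ (role₁ V v₁ v₂ r)))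

absent-𝐂 : ∀ V → centre V ≢ 𝐂 → through V 2 ≡ 0
absent-𝐂 V c≢𝐂 = count-none λ v₁ v₂ r → c≢𝐂 (proj₁ (proj₂ (proj₂ (role₂ V v₁ v₂ r))))

load≡ : ∀ V {a b c} → through V 0 ≡ a → through V 1 ≡ b → through V 2 ≡ c → load V ≡ 2 * a + 4 * b + 4 * c
load≡ V refl refl refl = refl

paid≡ : ∀ V {l} → centre V ≡ l → paid V ≡ Σ⊕ (λ u₁ u₂ → claim (translate V u₁ u₂) l)
paid≡ V = cong (λ l → Σ⊕ λ u₁ u₂ → claim (translate V u₁ u₂) l)

local-∗ : ∀ V → centre V ≡ ∗ → load V + paid V ≤ 12 + received V
local-∗ V c≡∗ = ≤-trans (≤-reflexive (cong₂ _+_ (load≡ V (absent-𝐀 V (≡-≢ c≡∗ λ ())) (absent-𝐁 V (≡-≢ c≡∗ λ ())) (absent-𝐂 V (≡-≢ c≡∗ λ ())))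
                                                  (paid≡ V c≡∗))) z≤n

four-axes-bound : ∀ {K R} → K ≤ 4 → (4 ≤ K → 4 ≤ R) → 4 * K ≤ 12 + R
four-axes-bound {K} {R} K≤4 full with 4 ≤? K
... | yes 4≤K = ≤-trans (*-monoʳ-≤ 4 K≤4) (+-monoʳ-≤ 12 (full 4≤K))
... | no 4≰K = ≤-trans (*-monoʳ-≤ 4 (s≤s⁻¹ (≰⇒> 4≰K))) (m≤m+n 12 R)

opposite-letter : ∀ V {f l} → (∀ v₁ v₂ → T (f v₁ v₂) → nb V (neg v₁) (neg v₂) ≡ l) →
                  ∀ v₁ v₂ → T (occupied f v₁ v₂) → nb V (neg v₁) (neg v₂) ≡ l ⊎ nb V v₁ v₂ ≡ l
opposite-letter V f⇒l v₁ v₂ occ = ∨-elim occ (λ t → inj₁ (f⇒l v₁ v₂ t)) (λ t → inj₂ (trans (sym (nb-neg² V v₁ v₂)) (f⇒l _ _ t)))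

received-≥4 : ∀ V l → 2 ≤ claim V l → nb V 2F 0F ≡ l ⊎ nb V 1F 0F ≡ l → nb V 0F 2F ≡ l ⊎ nb V 0F 1F ≡ l → 4 ≤ received V
received-≥4 V l 2≤ horizontal vertical =
  ≤-trans (+-mono-≤ (pair horizontal) (pair vertical)) (≤-reflexive (sym (+-assoc (c 1F 0F + c 2F 0F) (c 0F 1F) (c 0F 2F))))
  where
  c : Fin 3 → Fin 3 → ℕ
  c v₁ v₂ = claim V (nb V v₁ v₂)
  pair : ∀ {p q} → p ≡ l ⊎ q ≡ l → 2 ≤ claim V q + claim V p
  pair (inj₁ refl) = ≤-trans 2≤ (m≤n+m _ _)
  pair (inj₂ refl) = ≤-trans 2≤ (m≤m+n _ _)

local-𝐂 : ∀ V → centre V ≡ 𝐂 → load V + paid V ≤ 12 + received V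
local-𝐂 V c≡𝐂 = begin
  load V + paid V
    ≡⟨ cong₂ _+_ (load≡ V (absent-𝐀 V (≡-≢ c≡𝐂 λ ())) (absent-𝐁 V (≡-≢ c≡𝐂 λ ())) refl) (paid≡ V c≡𝐂) ⟩
  4 * through V 2 + 0
    ≡⟨ +-identityʳ _ ⟩
  4 * through V 2
    ≤⟨ four-axes-bound (count-≤4 (role₂-free V)) full ⟩
  12 + received V ∎
  where
  open ≤-Reasoning
  full : 4 ≤ through V 2 → 4 ≤ received V
  full 4≤ = received-≥4 V 𝐁 (≤-trans (≤-reflexive (sym (cong (2 *_) (𝟙-true rich)))) (m≤n+m (2 * 𝟙 (rich𝐂 V)) (𝟙 (rich𝐀 V))))
    (opposite-letter V γ⇒𝐁 1F 0F (all-axes-occupied (role₂-free V) 4≤ 1F 0F tt))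
    (opposite-letter V γ⇒𝐁 0F 1F (all-axes-occupied (role₂-free V) 4≤ 0F 1F tt))
    where
    rich : T (rich𝐂 V)
    rich = ∧-intro (≡⇒T c≡𝐂) (≤⇒≤ᵇ 4≤)
    γ⇒𝐁 : ∀ v₁ v₂ → T (reads V (ℤ.- + 2) v₁ v₂) → nb V (neg v₁) (neg v₂) ≡ 𝐁
    γ⇒𝐁 v₁ v₂ r = proj₁ (proj₂ (role₂ V v₁ v₂ r))

-- o u: the neighbour in direction u is a rich 𝐁; b w: the neighbour in direction w is a 𝐁.
isolated : (Fin 3 → Fin 3 → Bool) → (Fin 3 → Fin 3 → Bool) → Bool
isolated o b = every⊕ λ u₁ u₂ → o u₁ u₂ ⇒ b u₁ u₂ ∧ not (sides _∨_ b u₁ u₂ ∨ corners _∨_ b u₁ u₂)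

isolated⇒bound : ∀ o b sa → sa ≤ count b → T (isolated o b) →
         2 * sa + Σ⊕ (λ u₁ u₂ → 2 * 𝟙 (o u₁ u₂)) ≤ 12 + Σ⊕ (λ u₁ u₂ → 𝟙 (b u₁ u₂ ∧ (7 ≤ᵇ sa)))
isolated⇒bound o b sa sa≤ iso = ≤ᵇ⇒≤ _ _ (∀≤ᵇ-sound (count b) (bound o b) (⇒-elim (decide⁴⁸ Φ tt o b) iso) sa sa≤)
  where
  bound : (Fin 3 → Fin 3 → Bool) → (Fin 3 → Fin 3 → Bool) → ℕ → Bool
  bound o b sa = 2 * sa + Σ⊕ (λ u₁ u₂ → 2 * 𝟙 (o u₁ u₂)) ≤ᵇ 12 + Σ⊕ (λ u₁ u₂ → 𝟙 (b u₁ u₂ ∧ (7 ≤ᵇ sa)))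
  Φ : (Fin 3 → Fin 3 → Bool) → (Fin 3 → Fin 3 → Bool) → Bool
  Φ o b = isolated o b ⇒ ∀≤ᵇ (count b) (bound o b)

claim-𝐁 : ∀ V l → 𝟙 ((l == 𝐁) ∧ rich𝐀 V) ≤ claim V l
claim-𝐁 V 𝐀 = z≤n
claim-𝐁 V 𝐁 = m≤m+n _ _
claim-𝐁 V 𝐂 = z≤n
claim-𝐁 V ∗ = z≤n

-- Seen from the neighbour at u, the centre's neighbour w sits at w - u.
rich𝐁-neighbours-isolated : ∀ V → T (isolated (λ u₁ u₂ → rich𝐁 (translate V u₁ u₂)) (is 𝐁 V))
rich𝐁-neighbours-isolated V =
  every⊕-intro {λ u₁ u₂ → rich𝐁 (translate V u₁ u₂) ⇒ is 𝐁 V u₁ u₂ ∧ not (sides _∨_ (is 𝐁 V) u₁ u₂ ∨ corners _∨_ (is 𝐁 V) u₁ u₂)}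
    (⇒-intro east , ⇒-intro west , ⇒-intro north , ⇒-intro south)
  where
  east : T (rich𝐁 (translate V 1F 0F)) → T (is 𝐁 V 1F 0F ∧ not (sides _∨_ (is 𝐁 V) 1F 0F ∨ corners _∨_ (is 𝐁 V) 1F 0F))
  east t = let c , around = rich𝐁-ring (translate V 1F 0F) t in ∧-intro (≡⇒T c) (nor (nor (around 2F 1F tt) (around 2F 2F tt)) (nor (around 0F 1F tt) (around 0F 2F tt)))
  west : T (rich𝐁 (translate V 2F 0F)) → T (is 𝐁 V 2F 0F ∧ not (sides _∨_ (is 𝐁 V) 2F 0F ∨ corners _∨_ (is 𝐁 V) 2F 0F))
  west t = let c , around = rich𝐁-ring (translate V 2F 0F) t in ∧-intro (≡⇒T c) (nor (nor (around 1F 1F tt) (around 1F 2F tt)) (nor (around 0F 1F tt) (around 0F 2F tt)))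
  north : T (rich𝐁 (translate V 0F 1F)) → T (is 𝐁 V 0F 1F ∧ not (sides _∨_ (is 𝐁 V) 0F 1F ∨ corners _∨_ (is 𝐁 V) 0F 1F))
  north t = let c , around = rich𝐁-ring (translate V 0F 1F) t in ∧-intro (≡⇒T c) (nor (nor (around 1F 2F tt) (around 2F 2F tt)) (nor (around 1F 0F tt) (around 2F 0F tt)))
  south : T (rich𝐁 (translate V 0F 2F)) → T (is 𝐁 V 0F 2F ∧ not (sides _∨_ (is 𝐁 V) 0F 2F ∨ corners _∨_ (is 𝐁 V) 0F 2F))
  south t = let c , around = rich𝐁-ring (translate V 0F 2F) t in ∧-intro (≡⇒T c) (nor (nor (around 1F 1F tt) (around 2F 1F tt)) (nor (around 1F 0F tt) (around 2F 0F tt)))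

local-𝐀 : ∀ V → centre V ≡ 𝐀 → load V + paid V ≤ 12 + received V
local-𝐀 V c≡𝐀 = begin
  load V + paid V
    ≡⟨ cong₂ _+_ (load≡ V refl (absent-𝐁 V (≡-≢ c≡𝐀 λ ())) (absent-𝐂 V (≡-≢ c≡𝐀 λ ()))) (paid≡ V c≡𝐀) ⟩
  2 * SA + 0 + 0 + Σ⊕ (λ u₁ u₂ → 2 * 𝟙 (rich𝐁 (translate V u₁ u₂)))
    ≡⟨ cong (_+ Σ⊕ (λ u₁ u₂ → 2 * 𝟙 (rich𝐁 (translate V u₁ u₂)))) (trans (+-identityʳ (2 * SA + 0)) (+-identityʳ (2 * SA))) ⟩
  2 * SA + Σ⊕ (λ u₁ u₂ → 2 * 𝟙 (rich𝐁 (translate V u₁ u₂)))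
    ≤⟨ isolated⇒bound (λ u₁ u₂ → rich𝐁 (translate V u₁ u₂)) (is 𝐁 V) SA (count-mono λ v₁ v₂ r → ≡⇒T (proj₂ (role₀ V v₁ v₂ r)))
              (rich𝐁-neighbours-isolated V) ⟩
  12 + Σ⊕ (λ u₁ u₂ → 𝟙 (is 𝐁 V u₁ u₂ ∧ (7 ≤ᵇ SA)))
    ≤⟨ +-monoʳ-≤ 12 (Σ⊕-mono-≤ {λ u₁ u₂ → 𝟙 (is 𝐁 V u₁ u₂ ∧ (7 ≤ᵇ SA))} {λ u₁ u₂ → claim V (nb V u₁ u₂)} (all⊕ λ u₁ u₂ →
         subst (λ r → 𝟙 (is 𝐁 V u₁ u₂ ∧ r) ≤ claim V (nb V u₁ u₂)) (cong (λ c → (c == 𝐀) ∧ (7 ≤ᵇ SA)) c≡𝐀) (claim-𝐁 V (nb V u₁ u₂)))) ⟩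
  12 + received V ∎
  where
  open ≤-Reasoning
  SA : ℕ
  SA = through V 0

blocked : (Fin 3 → Fin 3 → Bool) → Fin 3 → Fin 3 → Bool
blocked f u₁ u₂ = not (sides _∨_ (occupied f) u₁ u₂) ∧ not (corners _∧_ (occupied f) u₁ u₂)

blocked-counting : ∀ f → T (exclusive-on-axes f ⇒ every⊕ (λ u₁ u₂ → blocked f u₁ u₂ ⇒ (count f ≤ᵇ 2)))
blocked-counting = decide⁸ (λ f → exclusive-on-axes f ⇒ every⊕ (λ u₁ u₂ → blocked f u₁ u₂ ⇒ (count f ≤ᵇ 2))) tt

blocked⇒count-≤2 : ∀ {f} → Antipodal-free f → All⊕ (λ u₁ u₂ → T (blocked f u₁ u₂) → count f ≤ 2)
blocked⇒count-≤2 {f} free = All⊕-map {λ u₁ u₂ → T (blocked f u₁ u₂ ⇒ (count f ≤ᵇ 2))} (λ t b → ≤ᵇ⇒≤ (count f) 2 (⇒-elim t b))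
  (every⊕-elim {λ u₁ u₂ → blocked f u₁ u₂ ⇒ (count f ≤ᵇ 2)} (⇒-elim (blocked-counting f) (exclusive-on-axes-intro free)))

solitary : (Fin 3 → Fin 3 → Bool) → (Fin 3 → Fin 3 → Bool) → Bool
solitary oa oc = every⊕ λ u₁ u₂ → oc u₁ u₂ ⇒ not (oa u₁ u₂ ∨ oc (neg u₁) (neg u₂) ∨ sides _∨_ oa u₁ u₂ ∨ sides _∨_ oc u₁ u₂)

solitary⇒≤4 : ∀ oa oc → T (solitary oa oc) → Σ⊕ (λ u₁ u₂ → 𝟙 (oa u₁ u₂) + 2 * 𝟙 (oc u₁ u₂)) ≤ 4
solitary⇒≤4 oa oc t = ≤ᵇ⇒≤ _ 4 (⇒-elim (decide⁴⁴ Φ tt oa oc) t)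
  where
  Φ : (Fin 3 → Fin 3 → Bool) → (Fin 3 → Fin 3 → Bool) → Bool
  Φ oa oc = solitary oa oc ⇒ (Σ⊕ (λ u₁ u₂ → 𝟙 (oa u₁ u₂) + 2 * 𝟙 (oc u₁ u₂)) ≤ᵇ 4)

-- Let K axes through the 𝐁-centre carry an appearance. A rich neighbour forbids an
-- appearance on the perpendicular axis and on one diagonal, so K ≤ 2 as soon as anybody
-- claims from the centre, and the claims never exceed 4. If K = 4, the horizontal and the
-- vertical axis each end in an 𝐀 which pays 2.
module Centre𝐁 (V : View) (c≡𝐁 : centre V ≡ 𝐁) where

  open ≤-Reasoning

  β : Fin 3 → Fin 3 → Bool
  β = reads V (ℤ.- + 1)

  oa oc : Fin 3 → Fin 3 → Bool
  oa u₁ u₂ = rich𝐀 (translate V u₁ u₂)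
  oc u₁ u₂ = rich𝐂 (translate V u₁ u₂)

  β⇒𝐀 : ∀ v₁ v₂ → T (β v₁ v₂) → nb V (neg v₁) (neg v₂) ≡ 𝐀
  β⇒𝐀 v₁ v₂ r = proj₁ (role₁ V v₁ v₂ r)

  𝐁-unoccupied : ∀ w₁ w₂ → nb V w₁ w₂ ≡ 𝐁 → T (not (occupied β w₁ w₂))
  𝐁-unoccupied w₁ w₂ b = nor (not-intro λ r → 𝐁≢𝐂 (trans (sym b) (proj₂ (proj₂ (role₁ V w₁ w₂ r)))))
                              (not-intro λ r → 𝐁≢𝐀 (trans (sym b) (trans (sym (nb-neg² V w₁ w₂)) (β⇒𝐀 (neg w₁) (neg w₂) r))))
    where
    𝐁≢𝐂 : 𝐁 ≢ 𝐂
    𝐁≢𝐂 ()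
    𝐁≢𝐀 : 𝐁 ≢ 𝐀
    𝐁≢𝐀 ()

  not-𝐀-unoccupied : ∀ w₁ w₂ → T (not (is 𝐀 V w₁ w₂)) → T (not (is 𝐀 V (neg w₁) (neg w₂))) → T (not (occupied β w₁ w₂))
  not-𝐀-unoccupied w₁ w₂ ¬𝐀 ¬𝐀′ = nor (not-intro λ r → not-elim ¬𝐀′ (≡⇒T (β⇒𝐀 w₁ w₂ r)))
                                      (not-intro λ r → not-elim ¬𝐀 (≡⇒T (trans (sym (nb-neg² V w₁ w₂)) (β⇒𝐀 (neg w₁) (neg w₂) r))))

  unoccupied-axis : ∀ w₁ w₂ → T (not (occupied β w₁ w₂)) → T (not (occupied β w₁ w₂ ∨ occupied β (neg w₁) (neg w₂)))
  unoccupied-axis w₁ w₂ n = nor n (not-intro λ o → not-elim n (subst₂ (λ a b → T (occupied β a b)) (neg² w₁) (neg² w₂) (occupied-neg β (neg w₁) (neg w₂) o)))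

  side-axis-free : ∀ s₁ s₂ → T (is 𝐁 V s₁ s₂ ∨ is 𝐁 V (neg s₁) (neg s₂)) ⊎ T (not (is 𝐀 V s₁ s₂) ∧ not (is 𝐀 V (neg s₁) (neg s₂))) →
                   T (not (occupied β s₁ s₂ ∨ occupied β (neg s₁) (neg s₂)))
  side-axis-free s₁ s₂ (inj₁ b) = unoccupied-axis s₁ s₂ (∨-elim b (λ t → 𝐁-unoccupied s₁ s₂ (T-== t))
    (λ t → not-intro λ o → not-elim (𝐁-unoccupied (neg s₁) (neg s₂) (T-== t)) (occupied-neg β s₁ s₂ o)))
  side-axis-free s₁ s₂ (inj₂ ¬𝐀) = unoccupied-axis s₁ s₂ (not-𝐀-unoccupied s₁ s₂ (proj₁ (∧-elim ¬𝐀)) (proj₂ (∧-elim {not (is 𝐀 V s₁ s₂)} ¬𝐀)))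

  corner-free : ∀ k₁ k₂ k₁′ k₂′ → T (is 𝐁 V k₁ k₂ ∨ is 𝐁 V k₁′ k₂′) → T (not (occupied β k₁ k₂ ∧ occupied β k₁′ k₂′))
  corner-free k₁ k₂ k₁′ k₂′ b = ∨-elim b
    (λ t → not-intro λ both → not-elim (𝐁-unoccupied k₁ k₂ (T-== t)) (proj₁ (∧-elim both)))
    (λ t → not-intro λ both → not-elim (𝐁-unoccupied k₁′ k₂′ (T-== t)) (proj₂ (∧-elim {occupied β k₁ k₂} both)))

  blocked-if : ∀ u₁ u₂ → T (sides _∨_ (is 𝐁 V) u₁ u₂) ⊎ T (sides (λ a b → not a ∧ not b) (is 𝐀 V) u₁ u₂) →
               T (corners _∨_ (is 𝐁 V) u₁ u₂) → T (blocked β u₁ u₂)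
  blocked-if u₁ 0F s c = ∧-intro (side-axis-free 0F 1F s) (corner-free u₁ 1F u₁ 2F c)
  blocked-if u₁ (suc u₂) s c = ∧-intro (side-axis-free 1F 0F s) (corner-free 1F (suc u₂) 2F (suc u₂) c)

  K P : ℕ
  K = count β
  P = Σ⊕ (λ u₁ u₂ → 𝟙 (oa u₁ u₂) + 2 * 𝟙 (oc u₁ u₂))

  decompose : load V + paid V ≡ 4 * K + P
  decompose = cong₂ _+_ (trans (load≡ V (absent-𝐀 V (≡-≢ c≡𝐁 λ ())) refl (absent-𝐂 V (≡-≢ c≡𝐁 λ ()))) (+-identityʳ (4 * K))) (paid≡ V c≡𝐁)

  Rich𝐀-facts Rich𝐂-facts : Fin 3 → Fin 3 → Set
  Rich𝐀-facts u₁ u₂ = T (oa u₁ u₂) → T (sides _∨_ (is 𝐁 V) u₁ u₂) × T (corners _∨_ (is 𝐁 V) u₁ u₂)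
  Rich𝐂-facts u₁ u₂ = T (oc u₁ u₂) →
    nb V (neg u₁) (neg u₂) ≡ 𝐀 × T (sides (λ a b → not a ∧ not b) (is 𝐀 V) u₁ u₂) × T (corners _∨_ (is 𝐁 V) u₁ u₂)

  rich𝐀-neighbours : All⊕ Rich𝐀-facts
  rich𝐀-neighbours = east , west , north , south
    where
    east : Rich𝐀-facts 1F 0F
    east t = let _ , (_ , w , _ , _) = rich𝐀-flanks (translate V 1F 0F) t in proj₂ (∧-elim w) , proj₁ (∧-elim w)
    west : Rich𝐀-facts 2F 0F
    west t = let _ , (e , _ , _ , _) = rich𝐀-flanks (translate V 2F 0F) t in proj₂ (∧-elim e) , proj₁ (∧-elim e)
    north : Rich𝐀-facts 0F 1F
    north t = let _ , (_ , _ , _ , s) = rich𝐀-flanks (translate V 0F 1F) t in proj₂ (∧-elim s) , proj₁ (∧-elim s)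
    south : Rich𝐀-facts 0F 2F
    south t = let _ , (_ , _ , n , _) = rich𝐀-flanks (translate V 0F 2F) t in proj₂ (∧-elim n) , proj₁ (∧-elim n)

  rich𝐂-neighbours : All⊕ Rich𝐂-facts
  rich𝐂-neighbours = east , west , north , south
    where
    east : Rich𝐂-facts 1F 0F
    east t = let open Rich𝐂 (translate V 1F 0F) t in
      behind 1F 0F tt c≡𝐁 , ∧-intro (ring-not-𝐀 2F 1F tt) (ring-not-𝐀 2F 2F tt) , axis-𝐁 0F 1F tt
    west : Rich𝐂-facts 2F 0F
    west t = let open Rich𝐂 (translate V 2F 0F) t in
      behind 2F 0F tt c≡𝐁 , ∧-intro (ring-not-𝐀 1F 1F tt) (ring-not-𝐀 1F 2F tt) , axis-𝐁 0F 1F tt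
    north : Rich𝐂-facts 0F 1F
    north t = let open Rich𝐂 (translate V 0F 1F) t in
      behind 0F 1F tt c≡𝐁 , ∧-intro (ring-not-𝐀 1F 2F tt) (ring-not-𝐀 2F 2F tt) , axis-𝐁 1F 0F tt
    south : Rich𝐂-facts 0F 2F
    south t = let open Rich𝐂 (translate V 0F 2F) t in
      behind 0F 2F tt c≡𝐁 , ∧-intro (ring-not-𝐀 1F 1F tt) (ring-not-𝐀 2F 1F tt) , axis-𝐁 1F 0F tt

  ¬oa-if : ∀ u₁ u₂ → nb V u₁ u₂ ≢ 𝐀 → T (not (oa u₁ u₂))
  ¬oa-if u₁ u₂ ne = not-intro λ t → ne (trans (sym (centre-translate V u₁ u₂)) (proj₁ (rich𝐀-flanks (translate V u₁ u₂) t)))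

  ¬oc-if : ∀ u₁ u₂ → nb V u₁ u₂ ≢ 𝐂 → T (not (oc u₁ u₂))
  ¬oc-if u₁ u₂ ne = not-intro λ t → ne (trans (sym (centre-translate V u₁ u₂)) (Rich𝐂.centre≡𝐂 (translate V u₁ u₂) t))

  ¬oc-via : ∀ u₁ u₂ → Rich𝐂-facts u₁ u₂ → nb V (neg u₁) (neg u₂) ≢ 𝐀 → T (not (oc u₁ u₂))
  ¬oc-via u₁ u₂ facts ne = not-intro λ t → ne (proj₁ (facts t))

  not-𝐀 : ∀ w₁ w₂ → T (not (is 𝐀 V w₁ w₂)) → nb V w₁ w₂ ≢ 𝐀
  not-𝐀 w₁ w₂ t eq = not-elim t (≡⇒T eq)

  alone : ∀ u₁ u₂ → All⊕ Rich𝐂-facts → Rich𝐂-facts u₁ u₂ →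
          T (oc u₁ u₂ ⇒ not (oa u₁ u₂ ∨ oc (neg u₁) (neg u₂) ∨ sides _∨_ oa u₁ u₂ ∨ sides _∨_ oc u₁ u₂))
  alone u₁ 0F (_ , _ , fn , fs) fu = ⇒-intro λ t →
    let a , s¬𝐀 , _ = fu t
        n¬𝐀 , s¬𝐀′ = ∧-elim s¬𝐀
    in nor (¬oa-if u₁ 0F (≡-≢ (here t) λ ())) (nor (¬oc-if (neg u₁) 0F (≡-≢ a λ ()))
         (nor (nor (¬oa-if 0F 1F (not-𝐀 0F 1F n¬𝐀)) (¬oa-if 0F 2F (not-𝐀 0F 2F s¬𝐀′))) (nor (¬oc-via 0F 1F fn (not-𝐀 0F 2F s¬𝐀′)) (¬oc-via 0F 2F fs (not-𝐀 0F 1F n¬𝐀)))))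
    where
    here : T (oc u₁ 0F) → nb V u₁ 0F ≡ 𝐂
    here t = trans (sym (centre-translate V u₁ 0F)) (Rich𝐂.centre≡𝐂 (translate V u₁ 0F) t)
  alone u₁ (suc u₂) (fe , fw , _ , _) fu = ⇒-intro λ t →
    let a , s¬𝐀 , _ = fu t
        e¬𝐀 , w¬𝐀 = ∧-elim s¬𝐀
    in nor (¬oa-if u₁ (suc u₂) (≡-≢ (here t) λ ())) (nor (¬oc-if (neg u₁) (neg (suc u₂)) (≡-≢ a λ ()))
         (nor (nor (¬oa-if 1F 0F (not-𝐀 1F 0F e¬𝐀)) (¬oa-if 2F 0F (not-𝐀 2F 0F w¬𝐀))) (nor (¬oc-via 1F 0F fe (not-𝐀 2F 0F w¬𝐀)) (¬oc-via 2F 0F fw (not-𝐀 1F 0F e¬𝐀)))))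
    where
    here : T (oc u₁ (suc u₂)) → nb V u₁ (suc u₂) ≡ 𝐂
    here t = trans (sym (centre-translate V u₁ (suc u₂))) (Rich𝐂.centre≡𝐂 (translate V u₁ (suc u₂)) t)

  flags-solitary : T (solitary oa oc)
  flags-solitary = every⊕-intro {λ u₁ u₂ → oc u₁ u₂ ⇒ not (oa u₁ u₂ ∨ oc (neg u₁) (neg u₂) ∨ sides _∨_ oa u₁ u₂ ∨ sides _∨_ oc u₁ u₂)}
    (alone 1F 0F F (proj₁ F) , alone 2F 0F F (proj₁ (proj₂ F)) , alone 0F 1F F (proj₁ (proj₂ (proj₂ F))) , alone 0F 2F F (proj₂ (proj₂ (proj₂ F))))
    where
    F : All⊕ Rich𝐂-facts
    F = rich𝐂-neighbours

  flag-blocked : ∀ u₁ u₂ → Rich𝐀-facts u₁ u₂ → Rich𝐂-facts u₁ u₂ → T (oa u₁ u₂ ∨ oc u₁ u₂) → T (blocked β u₁ u₂)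
  flag-blocked u₁ u₂ fa fc flag = ∨-elim flag
    (λ t → let s , k = fa t in blocked-if u₁ u₂ (inj₁ s) k)
    (λ t → let _ , s , k = fc t in blocked-if u₁ u₂ (inj₂ s) k)

  flagged⇒≤2 : All⊕ (λ u₁ u₂ → T (oa u₁ u₂ ∨ oc u₁ u₂) → count β ≤ 2)
  flagged⇒≤2 with rich𝐀-neighbours | rich𝐂-neighbours | blocked⇒count-≤2 (role₁-free V)
  ... | ae , aw , an , as | ce , cw , cn , cs | be , bw , bn , bs =
    (λ f → be (flag-blocked 1F 0F ae ce f)) , (λ f → bw (flag-blocked 2F 0F aw cw f)) ,
    (λ f → bn (flag-blocked 0F 1F an cn f)) , (λ f → bs (flag-blocked 0F 2F as cs f))

  unflagged : ∀ {a b} → (T (a ∨ b) → ⊥) → 𝟙 a + 2 * 𝟙 b ≤ 0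
  unflagged {false} {false} _ = z≤n
  unflagged {true} ¬f = ⊥-elim (¬f tt)
  unflagged {false} {true} ¬f = ⊥-elim (¬f tt)

  local : load V + paid V ≤ 12 + received V
  local with count β ≤? 2
  ... | yes K≤2 = begin
    load V + paid V  ≡⟨ decompose ⟩
    4 * K + P        ≤⟨ +-mono-≤ (*-monoʳ-≤ 4 K≤2) (solitary⇒≤4 oa oc flags-solitary) ⟩
    12               ≤⟨ m≤m+n 12 (received V) ⟩
    12 + received V  ∎
  ... | no K≰2 = begin
    load V + paid V  ≡⟨ decompose ⟩
    4 * K + P        ≤⟨ +-monoʳ-≤ (4 * K) (Σ⊕-mono-≤ {λ u₁ u₂ → 𝟙 (oa u₁ u₂) + 2 * 𝟙 (oc u₁ u₂)} {λ _ _ → 0}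
                          (All⊕-map {λ u₁ u₂ → T (oa u₁ u₂ ∨ oc u₁ u₂) → K ≤ 2}
                                    (λ {u₁} {u₂} ≤2 → unflagged {oa u₁ u₂} {oc u₁ u₂} (λ f → K≰2 (≤2 f))) flagged⇒≤2)) ⟩
    4 * K + 0        ≡⟨ +-identityʳ (4 * K) ⟩
    4 * K            ≤⟨ four-axes-bound (count-≤4 (role₁-free V)) full ⟩
    12 + received V  ∎
    where
    full : 4 ≤ K → 4 ≤ received V
    full 4≤ = received-≥4 V 𝐀 (≤-reflexive (sym (cong (2 *_) (𝟙-true (∧-intro (≡⇒T c≡𝐁) (≤⇒≤ᵇ 4≤))))))
      (opposite-letter V β⇒𝐀 1F 0F (all-axes-occupied (role₁-free V) 4≤ 1F 0F tt))
      (opposite-letter V β⇒𝐀 0F 1F (all-axes-occupied (role₁-free V) 4≤ 0F 1F tt))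

local-inequality : ∀ V → load V + paid V ≤ 12 + received V
local-inequality V = by-centre (centre V) refl
  where
  by-centre : ∀ l → centre V ≡ l → load V + paid V ≤ 12 + received V
  by-centre 𝐀 = local-𝐀 V
  by-centre 𝐁 = Centre𝐁.local V
  by-centre 𝐂 = local-𝐂 V
  by-centre ∗ = local-∗ V

-- The bound is attained

/-≤-cross : ∀ m n d e → m * suc e ≤ n * suc d → (+ m) / suc d ℚ.≤ (+ n) / suc e
/-≤-cross m n d e h = ℚ.toℚᵘ-cancel-≤
  (ℚᵘ.≤-respˡ-≃ (ℚᵘ.≃-sym (ℚ.toℚᵘ-fromℚᵘ (mkℚᵘ (+ m) d)))
    (ℚᵘ.≤-respʳ-≃ (ℚᵘ.≃-sym (ℚ.toℚᵘ-fromℚᵘ (mkℚᵘ (+ n) e)))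
      (*≤* (subst₂ ℤ._≤_ (sym (ℤ.+◃n≡+n (m * suc e))) (sym (ℤ.+◃n≡+n (n * suc d))) (ℤ.+≤+ h)))))

module Strip {Σ : Set} (_≟_ : DecidableEquality Σ) (A B C : Σ) where

  ABCCB : Fin 5 → Σ
  ABCCB 0F = A
  ABCCB 1F = B
  ABCCB 2F = C
  ABCCB 3F = C
  ABCCB 4F = B

  strip : Grid2 Σ
  strip = grid 0 4 (λ _ → ABCCB)

  -- In a grid of width 1 the horizontal component of a direction is irrelevant, so the 𝐀
  -- starts an appearance in each of the six directions with vertical component ±1.
  vertical : Fin 1 → Fin 5 → Fin 3 → Fin 3 → ℕ
  vertical 0F 0F _ 1F = 1
  vertical 0F 0F _ 2F = 1
  vertical _ _ _ _ = 0

  ⌊≟⌋-refl : ∀ x → ⌊ x ≟ x ⌋ ≡ true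
  ⌊≟⌋-refl x = trans (isYes≗does (x ≟ x)) (dec-true (x ≟ x) refl)

  spelled : 1 ≤ 𝟙 (⌊ A ≟ A ⌋ ∧ ⌊ B ≟ B ⌋ ∧ ⌊ C ≟ C ⌋ ∧ ⌊ C ≟ C ⌋ ∧ true)
  spelled rewrite ⌊≟⌋-refl A | ⌊≟⌋-refl B | ⌊≟⌋-refl C = s≤s z≤n

  vertical≤ : ∀ x y v₁ v₂ → vertical x y v₁ v₂ ≤ 𝟙 (nonzero v₁ v₂ ∧ isAppearance _≟_ (ABCC A B C) strip x y v₁ v₂)
  vertical≤ 0F 0F 0F 1F = spelled
  vertical≤ 0F 0F 1F 1F = spelled
  vertical≤ 0F 0F 2F 1F = spelled
  vertical≤ 0F 0F 0F 2F = spelled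
  vertical≤ 0F 0F 1F 2F = spelled
  vertical≤ 0F 0F 2F 2F = spelled
  vertical≤ 0F 0F _ 0F = z≤n
  vertical≤ 0F (suc _) _ _ = z≤n

  strip-concentration : (+ 6) / 5 ℚ.≤ c₂ _≟_ (ABCC A B C) strip
  strip-concentration = /-≤-cross 6 (appearances _≟_ (ABCC A B C) strip) 4 4 (*-monoˡ-≤ 5 (begin
    6                                                                                  ≤⟨ ∑²-mono-≤ (λ x y → ∑²-mono-≤ (vertical≤ x y)) ⟩
    ∑² (λ x y → ∑² λ v₁ v₂ → 𝟙 (nonzero v₁ v₂ ∧ isAppearance _≟_ (ABCC A B C) strip x y v₁ v₂)) ≡⟨ appearances≡∑² _≟_ (ABCC A B C) strip ⟨
    appearances _≟_ (ABCC A B C) strip                                                 ∎))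
    where open ≤-Reasoning

concentration-≤ : ∀ {Σ} (_≟_ : DecidableEquality Σ) {A B C : Σ} → A ≢ B → A ≢ C → B ≢ C →
                  ∀ g → c₂ _≟_ (ABCC A B C) g ℚ.≤ (+ 6) / 5
concentration-≤ _≟_ {A} {B} {C} A≢B A≢C B≢C g =
  /-≤-cross N 6 (b g + a g * suc (b g)) 4 (subst (_≤ 6 * size g) (*-comm 5 N) (discharging g local-inequality))
  where
  open Grids _≟_ A B C A≢B A≢C B≢C
  N : ℕ
  N = appearances _≟_ (ABCC A B C) g

q-ε<q : ∀ q {ε} → 0ℚ ℚ.< ε → q - ε ℚ.< q
q-ε<q q ε>0 = subst (q - _ ℚ.<_) (ℚ.+-identityʳ q) (ℚ.+-monoʳ-< q (ℚ.neg-antimono-< ε>0))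

lemma5p5 : (Σ : Set) (_≟_ : DecidableEquality Σ) (A B C : Σ) →
           A ≢ B → A ≢ C → B ≢ C →
           C₂≡ _≟_ (ABCC A B C) ((+ 6) / 5)
lemma5p5 Σ _≟_ A B C A≢B A≢C B≢C =
  concentration-≤ _≟_ A≢B A≢C B≢C ,
  λ ε ε>0 → strip , ℚ.<-≤-trans (q-ε<q ((+ 6) / 5) ε>0) strip-concentration
  where open Strip _≟_ A B C
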